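{- Let $n\ge2$ be an integer and let $A_{ij}$ be the coefficient of $u^iv^jw^{2n-i-j}$ in the numerator $P_{n/(n+1)}(u,v,w)$ of the Markov polynomial $M_{n/(n+1)}$. Then $A_{1,n}=4$.
   Context: Markov polynomials $M_\rho(x,y,z)$, $\rho\in\mathbb{Q}_{\ge0}\cup\{1/0\}$, are defined recursively by $M_{0/1}=x$, $M_{1/0}=y$, $M_{1/1}=(x^2+y^2)/z$, and: whenever $p/q$, $r/s$ are fractions in lowest terms with $p,q,r,s\ge0$, $qr-ps=1$, mediant $\mu=(p+r)/(q+s)$, then $M_{(2p+r)/(2q+s)}=(M_{p/q}^2+M_\mu^2)/M_{r/s}$ and $M_{(p+2r)/(q+2s)}=(M_\mu^2+M_{r/s}^2)/M_{p/q}$. For coprime positive $a,b$, $M_{a/b}=P_{a/b}(x^2,y^2,z^2)/(x^{a-1}y^{b-1}z^{a+b-1})$ with $P_{a/b}(u,v,w)$ homogeneous of degree $a+b-1$ (the numerator). -}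

module Defs where

open import Data.Nat as ℕ using (ℕ; zero; suc)
open import Data.Integer as ℤ using (ℤ; +_)
open import Data.Product using (_×_; _,_)
open import Data.List using (List; []; _∷_; _++_; concatMap; map)
open import Data.Bool using (if_then_else_; _∧_)
open import Relation.Nullary using (does)
open import Relation.Binary.PropositionalEquality using (_≡_)

-- A polynomial is a finite (unnormalised) list of terms c·X^i Y^j Z^k;
-- its meaning is given by the coefficient function `coeff`, and two
-- polynomials are equal (_≈ₚ_) iff all their coefficients agree.

Term : Set
Term = ℤ × ℕ × ℕ × ℕ

Poly : Set
Poly = List Term

coeff : Poly → ℕ → ℕ → ℕ → ℤ
coeff [] i j k = + 0
coeff ((c , a , b , d) ∷ p) i j k =
  (if does (a ℕ.≟ i) ∧ does (b ℕ.≟ j) ∧ does (d ℕ.≟ k) then c else + 0)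
  ℤ.+ coeff p i j k

_≈ₚ_ : Poly → Poly → Set
p ≈ₚ q = ∀ i j k → coeff p i j k ≡ coeff q i j k

infix 4 _≈ₚ_
infixl 6 _+ₚ_
infixl 7 _*ₚ_

_+ₚ_ : Poly → Poly → Poly
p +ₚ q = p ++ q

mulTerm : Term → Term → Term
mulTerm (c , a , b , d) (c' , a' , b' , d') = (c ℤ.* c' , a ℕ.+ a' , b ℕ.+ b' , d ℕ.+ d')

_*ₚ_ : Poly → Poly → Poly
p *ₚ q = concatMap (λ t → map (mulTerm t) q) p

mono : ℕ → ℕ → ℕ → Poly
mono a b c = (+ 1 , a , b , c) ∷ []

X Y Z : Poly
X = mono 1 0 0
Y = mono 0 1 0
Z = mono 0 0 1

squareVars : Poly → Poly
squareVars = map (λ { (c , a , b , d) → (c , 2 ℕ.* a , 2 ℕ.* b , 2 ℕ.* d) })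

-- Rational functions in x, y, z as formal fractions num/den
-- (field of fractions of ℤ[x,y,z]); only ring operations are needed.

record Frac : Set where
  constructor _/ₚ_
  field
    num : Poly
    den : Poly
open Frac public

sqsumDiv : Frac → Frac → Frac → Frac
sqsumDiv (a /ₚ a') (b /ₚ b') (c /ₚ c') =
  ((a *ₚ a *ₚ b' *ₚ b' +ₚ b *ₚ b *ₚ a' *ₚ a') *ₚ c')
    /ₚ (a' *ₚ a' *ₚ b' *ₚ b' *ₚ c)

-- A node is a Farey pair p/q < r/s (qr - ps = 1) whose mediant is
-- (p+r)/(q+s); every Farey pair, and hence every fraction a/b with
-- a ≥ 0, b ≥ 1 other than 0/1, occurs (as a mediant) in this tree.
-- A node stores the two fractions and the Markov polynomials
-- M_{p/q}, M_{mediant}, M_{r/s}.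

data Dir : Set where
  L R : Dir

record Node : Set where
  constructor node
  field
    p q r s : ℕ
    Mleft Mmed Mright : Frac
open Node public

root : Node
root = node 0 1 1 0
  (X /ₚ mono 0 0 0)
  ((X *ₚ X +ₚ Y *ₚ Y) /ₚ Z)
  (Y /ₚ mono 0 0 0)

step : Dir → Node → Node
step L (node p q r s Ml Mm Mr) =
  node p q (p ℕ.+ r) (q ℕ.+ s) Ml (sqsumDiv Ml Mm Mr) Mm
step R (node p q r s Ml Mm Mr) =
  node (p ℕ.+ r) (q ℕ.+ s) r s Mm (sqsumDiv Mm Mr Ml) Mr

nodeAt : List Dir → Node
nodeAt ds = go ds root
  where
  go : List Dir → Node → Node
  go [] nd = nd
  go (d ∷ ds) nd = go ds (step d nd)

medNum medDen : Node → ℕ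
medNum nd = p nd ℕ.+ r nd
medDen nd = q nd ℕ.+ s nd

-- "P is the numerator P_{a/b} of the Markov polynomial M (= mediant
-- value at the node)":  M = P(x²,y²,z²) / (x^{a-1} y^{b-1} z^{a+b-1}),
-- written cross-multiplied.
IsNumerator : ℕ → ℕ → Frac → Poly → Set
IsNumerator a b M P =
  num M *ₚ mono (a ℕ.∸ 1) (b ℕ.∸ 1) (a ℕ.+ b ℕ.∸ 1) ≈ₚ den M *ₚ squareVars P

-- Along the Stern–Brocot path L Rⁿ⁻¹, the only one reaching n/(n+1), the Markov polynomials
-- Mₖ = M_{k/(k+1)} satisfy Mₖ₊₂ = (Mₖ₊₁² + M_{1/1}²)/Mₖ.  Their numerators Pₖ(u,v,w) satisfy the
-- linear recurrence Pₖ₊₂ = (u+v)(u+v+w) Pₖ₊₁ − uvw² Pₖ: its Cassini identity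
-- Pₖ₊₂Pₖ − Pₖ₊₁² = (u+v)² vw (uvw²)ᵏ is exactly what turns one recurrence into the other.
-- Numerators are unique because denominators have positive coefficients and therefore are not
-- zero divisors (compare lexicographically leading terms).  Finally Pₖ(0,v,w) = vᵏ⁺¹wᵏ⁻¹, and
-- comparing coefficients of u vⁿ wⁿ⁻¹ in the linear recurrence gives A₁,ₙ = 1 + A₁,ₙ₋₁ − 1 = 4.

module Submission where

open import Defs
open import Data.Nat using (ℕ; suc; _≤_; _+_; _∸_; _*_)
open import Data.Integer using (+_)
open import Data.List using (List)
open import Data.Product using (Σ; _×_; _,_)
open import Relation.Binary.PropositionalEquality using (_≡_)

open import Algebra.Bundles using (CommutativeRing)
open import Algebra.Structures using (IsCommutativeRing)
open import Data.Bool using (true; false; if_then_else_)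
open import Data.Empty using (⊥; ⊥-elim)
open import Data.Integer as ℤ using (ℤ; 0ℤ; 1ℤ; +[1+_])
  renaming (_+_ to _+ℤ_; _*_ to _*ℤ_; -_ to -ℤ_)
import Data.Integer.Properties as ℤₚ
open import Data.List using ([]; _∷_; _++_; map; replicate)
open import Data.List.Membership.Propositional using (_∈_; _∉_)
open import Data.List.Membership.Propositional.Properties using (∈-map⁺; ∈-++⁺ˡ; ∈-++⁺ʳ)
open import Data.List.Relation.Unary.All as All using (All; all?)
import Data.List.Relation.Unary.All.Properties as All
open import Data.List.Relation.Unary.Any using (here; there)
open import Data.Nat as ℕ using (zero; _≟_; z≤n; s≤s)
import Data.Nat.Properties as ℕₚ
import Data.Nat.Tactic.RingSolver as ℕ-Solver
open import Data.Product using (proj₁; proj₂)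
open import Data.Product.Properties using (,-injectiveˡ; ,-injectiveʳ)
open import Data.Sum using (_⊎_; inj₁; inj₂; [_,_]′)
open import Data.Unit using (tt)
open import Function using (_∘_; _$_; _⟨_⟩_; case_of_)
open import Level using (0ℓ)
open import Relation.Binary.Definitions using (DecidableEquality; tri<; tri≈; tri>)
open import Relation.Binary.PropositionalEquality
  using (_≢_; refl; sym; trans; cong; cong₂; subst; module ≡-Reasoning)
import Relation.Binary.Reasoning.Setoid as SetoidReasoning
open import Relation.Nullary using (Dec; yes; no; does; ¬_; ¬?; contraposition)
open import Relation.Nullary.Decidable
  using (map′; _×-dec_; dec-true; dec-false; dec⇒maybe; True; toWitness; decidable-stable)
open import Algebra.Properties.CommutativeSemigroup ℤₚ.+-commutativeSemigroup
  using () renaming (interchange to +-interchange)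
import Tactic.RingSolver.Core.AlmostCommutativeRing as ACR
open import Tactic.RingSolver using (solve)

-- Polynomials as coefficient functions

Monomial : Set
Monomial = ℕ × ℕ × ℕ

infixl 6 _⊕_ _⊖_
infix 4 _∣ₘ_ _∣ₘ?_ _≟ₘ_

_⊕_ _⊖_ : Monomial → Monomial → Monomial
(a , b , c) ⊕ (a′ , b′ , c′) = (a + a′ , b + b′ , c + c′)
(a , b , c) ⊖ (a′ , b′ , c′) = (a ∸ a′ , b ∸ b′ , c ∸ c′)

_∣ₘ_ : Monomial → Monomial → Set
(a , b , c) ∣ₘ (a′ , b′ , c′) = a ≤ a′ × b ≤ b′ × c ≤ c′

_∣ₘ?_ : (α γ : Monomial) → Dec (α ∣ₘ γ)
(a , b , c) ∣ₘ? (a′ , b′ , c′) = a ℕ.≤? a′ ×-dec b ℕ.≤? b′ ×-dec c ℕ.≤? c′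

_≟ₘ_ : DecidableEquality Monomial
(a , b , c) ≟ₘ (a′ , b′ , c′) =
  map′ (λ { (refl , refl , refl) → refl }) (λ { refl → refl , refl , refl })
       (a ≟ a′ ×-dec b ≟ b′ ×-dec c ≟ c′)

α∣ₘα⊕β : ∀ α β → α ∣ₘ α ⊕ β
α∣ₘα⊕β (a , b , c) (a′ , b′ , c′) = ℕₚ.m≤m+n a a′ , ℕₚ.m≤m+n b b′ , ℕₚ.m≤m+n c c′

α⊕[γ⊖α]≡γ : ∀ {α γ} → α ∣ₘ γ → α ⊕ (γ ⊖ α) ≡ γ
α⊕[γ⊖α]≡γ (a≤ , b≤ , c≤) =
  cong₂ _,_ (ℕₚ.m+[n∸m]≡n a≤) (cong₂ _,_ (ℕₚ.m+[n∸m]≡n b≤) (ℕₚ.m+[n∸m]≡n c≤))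

[α⊕β]⊖α≡β : ∀ α β → α ⊕ β ⊖ α ≡ β
[α⊕β]⊖α≡β (a , b , c) (a′ , b′ , c′) =
  cong₂ _,_ (ℕₚ.m+n∸m≡n a a′) (cong₂ _,_ (ℕₚ.m+n∸m≡n b b′) (ℕₚ.m+n∸m≡n c c′))

⊕-comm : ∀ α β → α ⊕ β ≡ β ⊕ α
⊕-comm (a , b , c) (a′ , b′ , c′) =
  cong₂ _,_ (ℕₚ.+-comm a a′) (cong₂ _,_ (ℕₚ.+-comm b b′) (ℕₚ.+-comm c c′))

⊕-assoc : ∀ α β γ → α ⊕ β ⊕ γ ≡ α ⊕ (β ⊕ γ)
⊕-assoc (a , b , c) (a′ , b′ , c′) (a″ , b″ , c″) =
  cong₂ _,_ (ℕₚ.+-assoc a a′ a″) (cong₂ _,_ (ℕₚ.+-assoc b b′ b″) (ℕₚ.+-assoc c c′ c″))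

scalar : Term → ℤ
scalar (c , _) = c

monomial : Term → Monomial
monomial (_ , α) = α

-- Unfolds to the very test made by `coeff`, so `coeffₘ (t ∷ p) γ` reduces to `coeffₜ t γ +ℤ coeffₘ p γ`.
coeffₜ : Term → Monomial → ℤ
coeffₜ (c , α) γ = if does (α ≟ₘ γ) then c else 0ℤ

coeffₘ : Poly → Monomial → ℤ
coeffₘ p (i , j , k) = coeff p i j k

coeffₜ-≡ : ∀ t {γ} → monomial t ≡ γ → coeffₜ t γ ≡ scalar t
coeffₜ-≡ (c , α) {γ} α≡γ = cong (λ b → if b then c else 0ℤ) (dec-true (α ≟ₘ γ) α≡γ)

coeffₜ-≢ : ∀ t {γ} → monomial t ≢ γ → coeffₜ t γ ≡ 0ℤ
coeffₜ-≢ (c , α) {γ} α≢γ = cong (λ b → if b then c else 0ℤ) (dec-false (α ≟ₘ γ) α≢γ)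

mulTerm-comm : ∀ t s → mulTerm t s ≡ mulTerm s t
mulTerm-comm (c , α) (c′ , α′) = cong₂ _,_ (ℤₚ.*-comm c c′) (⊕-comm α α′)

mulTerm-assoc : ∀ t s r → mulTerm (mulTerm t s) r ≡ mulTerm t (mulTerm s r)
mulTerm-assoc (c , α) (c′ , α′) (c″ , α″) = cong₂ _,_ (ℤₚ.*-assoc c c′ c″) (⊕-assoc α α′ α″)

∑ : {A : Set} → List A → (A → ℤ) → ℤ
∑ [] f = 0ℤ
∑ (x ∷ xs) f = f x +ℤ ∑ xs f

infix 5 ∑
syntax ∑ xs (λ x → e) = ∑[ x ∈ xs ] e

module _ {A : Set} where

  ∑-cong : ∀ (xs : List A) {f g} → (∀ x → f x ≡ g x) → ∑ xs f ≡ ∑ xs g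
  ∑-cong [] f≗g = refl
  ∑-cong (x ∷ xs) f≗g = cong₂ _+ℤ_ (f≗g x) (∑-cong xs f≗g)

  ∑-++ : ∀ (xs ys : List A) f → ∑ (xs ++ ys) f ≡ ∑ xs f +ℤ ∑ ys f
  ∑-++ [] ys f = sym (ℤₚ.+-identityˡ _)
  ∑-++ (x ∷ xs) ys f = trans (cong (f x +ℤ_) (∑-++ xs ys f)) (sym (ℤₚ.+-assoc (f x) _ _))

  ∑-zero : ∀ (xs : List A) → ∑[ x ∈ xs ] 0ℤ ≡ 0ℤ
  ∑-zero [] = refl
  ∑-zero (x ∷ xs) = trans (ℤₚ.+-identityˡ _) (∑-zero xs)

  ∑-+ : ∀ (xs : List A) f g → ∑[ x ∈ xs ] (f x +ℤ g x) ≡ ∑ xs f +ℤ ∑ xs g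
  ∑-+ [] f g = refl
  ∑-+ (x ∷ xs) f g =
    trans (cong (f x +ℤ g x +ℤ_) (∑-+ xs f g)) (+-interchange (f x) (g x) (∑ xs f) (∑ xs g))

  ∑-*ˡ : ∀ (xs : List A) c f → ∑[ x ∈ xs ] (c *ℤ f x) ≡ c *ℤ ∑ xs f
  ∑-*ˡ [] c f = sym (ℤₚ.*-zeroʳ c)
  ∑-*ˡ (x ∷ xs) c f = trans (cong (c *ℤ f x +ℤ_) (∑-*ˡ xs c f)) (sym (ℤₚ.*-distribˡ-+ c (f x) (∑ xs f)))

  ∑-*ʳ : ∀ (xs : List A) c f → ∑[ x ∈ xs ] (f x *ℤ c) ≡ ∑ xs f *ℤ c
  ∑-*ʳ [] c f = sym (ℤₚ.*-zeroˡ c)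
  ∑-*ʳ (x ∷ xs) c f = trans (cong (f x *ℤ c +ℤ_) (∑-*ʳ xs c f)) (sym (ℤₚ.*-distribʳ-+ c (f x) (∑ xs f)))

∑-comm : ∀ {A B : Set} (xs : List A) (ys : List B) (f : A → B → ℤ) →
         ∑[ x ∈ xs ] ∑[ y ∈ ys ] f x y ≡ ∑[ y ∈ ys ] ∑[ x ∈ xs ] f x y
∑-comm [] ys f = sym (∑-zero ys)
∑-comm (x ∷ xs) ys f =
  trans (cong (∑ ys (f x) +ℤ_) (∑-comm xs ys f)) (sym (∑-+ ys (f x) (λ y → ∑[ x ∈ xs ] f x y)))

∑-map : ∀ {A B : Set} (h : A → B) xs (f : B → ℤ) → ∑ (map h xs) f ≡ ∑[ x ∈ xs ] f (h x)
∑-map h [] f = refl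
∑-map h (x ∷ xs) f = cong (f (h x) +ℤ_) (∑-map h xs f)

∑-cong-∈ : ∀ {A : Set} (xs : List A) {f g : A → ℤ} → (∀ {x} → x ∈ xs → f x ≡ g x) → ∑ xs f ≡ ∑ xs g
∑-cong-∈ [] f≗g = refl
∑-cong-∈ (x ∷ xs) f≗g = cong₂ _+ℤ_ (f≗g (here refl)) (∑-cong-∈ xs (f≗g ∘ there))

∑-*ₚ : ∀ p q f → ∑ (p *ₚ q) f ≡ ∑[ t ∈ p ] ∑[ s ∈ q ] f (mulTerm t s)
∑-*ₚ [] q f = refl
∑-*ₚ (t ∷ p) q f = begin
  ∑ (map (mulTerm t) q ++ p *ₚ q) f                ≡⟨ ∑-++ (map (mulTerm t) q) (p *ₚ q) f ⟩
  ∑ (map (mulTerm t) q) f +ℤ ∑ (p *ₚ q) f         ≡⟨ cong₂ _+ℤ_ (∑-map (mulTerm t) q f) (∑-*ₚ p q f) ⟩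
  (∑[ s ∈ q ] f (mulTerm t s)) +ℤ (∑[ t ∈ p ] ∑[ s ∈ q ] f (mulTerm t s)) ∎
  where open ≡-Reasoning

-ₚ_ : Poly → Poly
-ₚ_ = map λ (c , α) → (-ℤ c , α)

1ₚ : Poly
1ₚ = mono 0 0 0

coeffₘ-∑ : ∀ p γ → coeffₘ p γ ≡ ∑[ t ∈ p ] coeffₜ t γ
coeffₘ-∑ [] γ = refl
coeffₘ-∑ (t ∷ p) γ = cong (coeffₜ t γ +ℤ_) (coeffₘ-∑ p γ)

coeffₘ-++ : ∀ p q γ → coeffₘ (p ++ q) γ ≡ coeffₘ p γ +ℤ coeffₘ q γ
coeffₘ-++ p q γ = begin
  coeffₘ (p ++ q) γ                                ≡⟨ coeffₘ-∑ (p ++ q) γ ⟩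
  ∑ (p ++ q) (λ t → coeffₜ t γ)                    ≡⟨ ∑-++ p q _ ⟩
  ∑ p (λ t → coeffₜ t γ) +ℤ ∑ q (λ t → coeffₜ t γ) ≡⟨ cong₂ _+ℤ_ (coeffₘ-∑ p γ) (coeffₘ-∑ q γ) ⟨
  coeffₘ p γ +ℤ coeffₘ q γ                        ∎
  where open ≡-Reasoning

coeffₘ-neg : ∀ p γ → coeffₘ (-ₚ p) γ ≡ -ℤ coeffₘ p γ
coeffₘ-neg [] γ = refl
coeffₘ-neg ((c , α) ∷ p) γ = cong₂ _+ℤ_ (if-neg (does (α ≟ₘ γ))) (coeffₘ-neg p γ)
  ⟨ trans ⟩ sym (ℤₚ.neg-distrib-+ (coeffₜ (c , α) γ) (coeffₘ p γ))
  where
  if-neg : ∀ b → (if b then -ℤ c else 0ℤ) ≡ -ℤ (if b then c else 0ℤ)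
  if-neg true = refl
  if-neg false = refl

coeffₘ-* : ∀ p q γ → coeffₘ (p *ₚ q) γ ≡ ∑[ t ∈ p ] ∑[ s ∈ q ] coeffₜ (mulTerm t s) γ
coeffₘ-* p q γ = trans (coeffₘ-∑ (p *ₚ q) γ) (∑-*ₚ p q (λ u → coeffₜ u γ))

shiftedCoeff : Poly → Monomial → Monomial → ℤ
shiftedCoeff q α γ = if does (α ∣ₘ? γ) then coeffₘ q (γ ⊖ α) else 0ℤ

shiftedCoeff-∣ : ∀ q {α γ} → α ∣ₘ γ → shiftedCoeff q α γ ≡ coeffₘ q (γ ⊖ α)
shiftedCoeff-∣ q {α} {γ} α∣γ = cong (λ b → if b then coeffₘ q (γ ⊖ α) else 0ℤ) (dec-true (α ∣ₘ? γ) α∣γ)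

shiftedCoeff-∤ : ∀ q {α γ} → ¬ α ∣ₘ γ → shiftedCoeff q α γ ≡ 0ℤ
shiftedCoeff-∤ q {α} {γ} α∤γ = cong (λ b → if b then coeffₘ q (γ ⊖ α) else 0ℤ) (dec-false (α ∣ₘ? γ) α∤γ)

coeffₜ-mulTerm-∣ : ∀ t s {γ} → monomial t ∣ₘ γ →
                   coeffₜ (mulTerm t s) γ ≡ scalar t *ℤ coeffₜ s (γ ⊖ monomial t)
coeffₜ-mulTerm-∣ t s {γ} α∣γ with monomial s ≟ₘ γ ⊖ monomial t
... | yes β≡γ⊖α = begin
  coeffₜ (mulTerm t s) γ                 ≡⟨ coeffₜ-≡ (mulTerm t s) αβ≡γ ⟩
  scalar t *ℤ scalar s                   ≡⟨ cong (scalar t *ℤ_) (coeffₜ-≡ s β≡γ⊖α) ⟨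
  scalar t *ℤ coeffₜ s (γ ⊖ monomial t)  ∎
  where
  open ≡-Reasoning
  αβ≡γ : monomial t ⊕ monomial s ≡ γ
  αβ≡γ = trans (cong (monomial t ⊕_) β≡γ⊖α) (α⊕[γ⊖α]≡γ α∣γ)
... | no β≢γ⊖α = begin
  coeffₜ (mulTerm t s) γ                 ≡⟨ coeffₜ-≢ (mulTerm t s) αβ≢γ ⟩
  0ℤ                                     ≡⟨ ℤₚ.*-zeroʳ (scalar t) ⟨
  scalar t *ℤ 0ℤ                         ≡⟨ cong (scalar t *ℤ_) (coeffₜ-≢ s β≢γ⊖α) ⟨
  scalar t *ℤ coeffₜ s (γ ⊖ monomial t)  ∎
  where
  open ≡-Reasoning
  αβ≢γ : monomial t ⊕ monomial s ≢ γ
  αβ≢γ αβ≡γ = β≢γ⊖α (trans (sym ([α⊕β]⊖α≡β (monomial t) (monomial s))) (cong (_⊖ monomial t) αβ≡γ))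

coeffₜ-mulTerm-∤ : ∀ t s {γ} → ¬ monomial t ∣ₘ γ → coeffₜ (mulTerm t s) γ ≡ 0ℤ
coeffₜ-mulTerm-∤ t s α∤γ = coeffₜ-≢ (mulTerm t s) λ { refl → α∤γ (α∣ₘα⊕β (monomial t) (monomial s)) }

∑-coeffₜ-mulTerm : ∀ t q γ → ∑[ s ∈ q ] coeffₜ (mulTerm t s) γ ≡ scalar t *ℤ shiftedCoeff q (monomial t) γ
∑-coeffₜ-mulTerm t q γ with monomial t ∣ₘ? γ
... | yes α∣γ = begin
  ∑[ s ∈ q ] coeffₜ (mulTerm t s) γ             ≡⟨ ∑-cong q (λ s → coeffₜ-mulTerm-∣ t s α∣γ) ⟩
  ∑[ s ∈ q ] scalar t *ℤ coeffₜ s (γ ⊖ monomial t) ≡⟨ ∑-*ˡ q (scalar t) _ ⟩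
  scalar t *ℤ (∑[ s ∈ q ] coeffₜ s (γ ⊖ monomial t)) ≡⟨ cong (scalar t *ℤ_) (sym (coeffₘ-∑ q _)) ⟩
  scalar t *ℤ coeffₘ q (γ ⊖ monomial t)         ≡⟨ cong (scalar t *ℤ_) (sym (shiftedCoeff-∣ q α∣γ)) ⟩
  scalar t *ℤ shiftedCoeff q (monomial t) γ     ∎
  where open ≡-Reasoning
... | no α∤γ = begin
  ∑[ s ∈ q ] coeffₜ (mulTerm t s) γ          ≡⟨ ∑-cong q (λ s → coeffₜ-mulTerm-∤ t s α∤γ) ⟩
  ∑[ s ∈ q ] 0ℤ                              ≡⟨ ∑-zero q ⟩
  0ℤ                                         ≡⟨ sym (ℤₚ.*-zeroʳ (scalar t)) ⟩
  scalar t *ℤ 0ℤ                            ≡⟨ cong (scalar t *ℤ_) (sym (shiftedCoeff-∤ q α∤γ)) ⟩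
  scalar t *ℤ shiftedCoeff q (monomial t) γ ∎
  where open ≡-Reasoning

coeffₘ-*-shifted : ∀ p q γ → coeffₘ (p *ₚ q) γ ≡ ∑[ t ∈ p ] scalar t *ℤ shiftedCoeff q (monomial t) γ
coeffₘ-*-shifted p q γ = trans (coeffₘ-* p q γ) (∑-cong p (λ t → ∑-coeffₜ-mulTerm t q γ))

shiftedCoeff-vanishes : ∀ q α γ → (α ∣ₘ γ → coeffₘ q (γ ⊖ α) ≡ 0ℤ) → shiftedCoeff q α γ ≡ 0ℤ
shiftedCoeff-vanishes q α γ vanishes with α ∣ₘ? γ
... | yes α∣γ = trans (shiftedCoeff-∣ q α∣γ) (vanishes α∣γ)
... | no α∤γ = shiftedCoeff-∤ q α∤γ

shiftedCoeff-divides : ∀ q α γ {c} → α ∣ₘ γ → coeffₘ q (γ ⊖ α) ≡ c → shiftedCoeff q α γ ≡ c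
shiftedCoeff-divides q α γ α∣γ = trans (shiftedCoeff-∣ q α∣γ)

infix 4 _≋_

-- A record rather than a function type, so that p and q can be inferred from a proof.
record _≋_ (p q : Poly) : Set where
  constructor coeffwise
  field coeff-≡ : ∀ γ → coeffₘ p γ ≡ coeffₘ q γ
open _≋_

≋⇒≈ₚ : ∀ {p q} → p ≋ q → p ≈ₚ q
≋⇒≈ₚ p≋q i j k = coeff-≡ p≋q (i , j , k)

≈ₚ⇒≋ : ∀ {p q} → p ≈ₚ q → p ≋ q
≈ₚ⇒≋ p≈q = coeffwise λ (i , j , k) → p≈q i j k

≋-trans : ∀ {p q r} → p ≋ q → q ≋ r → p ≋ r
≋-trans p≋q q≋r = coeffwise λ γ → trans (coeff-≡ p≋q γ) (coeff-≡ q≋r γ)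

≋-refl : ∀ {p} → p ≋ p
≋-refl = coeffwise λ γ → refl

≋-sym : ∀ {p q} → p ≋ q → q ≋ p
≋-sym p≋q = coeffwise λ γ → sym (coeff-≡ p≋q γ)

≋-reflexive : ∀ {p q} → p ≡ q → p ≋ q
≋-reflexive refl = ≋-refl

+ₚ-cong : ∀ {p p′ q q′} → p ≋ p′ → q ≋ q′ → p +ₚ q ≋ p′ +ₚ q′
+ₚ-cong {p} {p′} {q} {q′} p≋p′ q≋q′ = coeffwise λ γ →
  coeffₘ-++ p q γ ⟨ trans ⟩ cong₂ _+ℤ_ (coeff-≡ p≋p′ γ) (coeff-≡ q≋q′ γ)
                  ⟨ trans ⟩ sym (coeffₘ-++ p′ q′ γ)

+ₚ-congˡ : ∀ p {q q′} → q ≋ q′ → p +ₚ q ≋ p +ₚ q′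
+ₚ-congˡ p q≋q′ = +ₚ-cong (≋-refl {p}) q≋q′

+ₚ-assoc : ∀ p q r → p +ₚ q +ₚ r ≋ p +ₚ (q +ₚ r)
+ₚ-assoc p q r = coeffwise λ γ → begin
  coeffₘ (p +ₚ q +ₚ r) γ                    ≡⟨ coeffₘ-++ (p +ₚ q) r γ ⟩
  coeffₘ (p +ₚ q) γ +ℤ coeffₘ r γ           ≡⟨ cong (_+ℤ coeffₘ r γ) (coeffₘ-++ p q γ) ⟩
  coeffₘ p γ +ℤ coeffₘ q γ +ℤ coeffₘ r γ    ≡⟨ ℤₚ.+-assoc (coeffₘ p γ) _ _ ⟩
  coeffₘ p γ +ℤ (coeffₘ q γ +ℤ coeffₘ r γ)  ≡⟨ cong (coeffₘ p γ +ℤ_) (coeffₘ-++ q r γ) ⟨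
  coeffₘ p γ +ℤ coeffₘ (q +ₚ r) γ           ≡⟨ coeffₘ-++ p (q +ₚ r) γ ⟨
  coeffₘ (p +ₚ (q +ₚ r)) γ                  ∎
  where open ≡-Reasoning

+ₚ-comm : ∀ p q → p +ₚ q ≋ q +ₚ p
+ₚ-comm p q = coeffwise λ γ →
  coeffₘ-++ p q γ ⟨ trans ⟩ ℤₚ.+-comm (coeffₘ p γ) _ ⟨ trans ⟩ sym (coeffₘ-++ q p γ)

+ₚ-identityʳ : ∀ p → p +ₚ [] ≋ p
+ₚ-identityʳ p = coeffwise λ γ → coeffₘ-++ p [] γ ⟨ trans ⟩ ℤₚ.+-identityʳ (coeffₘ p γ)

-ₚ-cong : ∀ {p q} → p ≋ q → -ₚ p ≋ -ₚ q
-ₚ-cong {p} {q} p≋q = coeffwise λ γ →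
  coeffₘ-neg p γ ⟨ trans ⟩ cong -ℤ_ (coeff-≡ p≋q γ) ⟨ trans ⟩ sym (coeffₘ-neg q γ)

-ₚ-inverseˡ : ∀ p → -ₚ p +ₚ p ≋ []
-ₚ-inverseˡ p = coeffwise λ γ →
  coeffₘ-++ (-ₚ p) p γ ⟨ trans ⟩ cong (_+ℤ coeffₘ p γ) (coeffₘ-neg p γ) ⟨ trans ⟩ ℤₚ.+-inverseˡ (coeffₘ p γ)

-ₚ-inverseʳ : ∀ p → p +ₚ -ₚ p ≋ []
-ₚ-inverseʳ p = ≋-trans (+ₚ-comm p (-ₚ p)) (-ₚ-inverseˡ p)

*ₚ-comm : ∀ p q → p *ₚ q ≋ q *ₚ p
*ₚ-comm p q = coeffwise λ γ → begin
  coeffₘ (p *ₚ q) γ                                   ≡⟨ coeffₘ-* p q γ ⟩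
  ∑[ t ∈ p ] ∑[ s ∈ q ] coeffₜ (mulTerm t s) γ        ≡⟨ ∑-comm p q _ ⟩
  ∑[ s ∈ q ] ∑[ t ∈ p ] coeffₜ (mulTerm t s) γ
      ≡⟨ ∑-cong q (λ s → ∑-cong p λ t → cong (λ u → coeffₜ u γ) (mulTerm-comm t s)) ⟩
  ∑[ s ∈ q ] ∑[ t ∈ p ] coeffₜ (mulTerm s t) γ        ≡⟨ coeffₘ-* q p γ ⟨
  coeffₘ (q *ₚ p) γ                                   ∎
  where open ≡-Reasoning

*ₚ-assoc : ∀ p q r → p *ₚ q *ₚ r ≋ p *ₚ (q *ₚ r)
*ₚ-assoc p q r = coeffwise λ γ → begin
  coeffₘ (p *ₚ q *ₚ r) γ                                         ≡⟨ coeffₘ-∑ (p *ₚ q *ₚ r) γ ⟩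
  ∑ (p *ₚ q *ₚ r) (λ u → coeffₜ u γ)                            ≡⟨ ∑-*ₚ (p *ₚ q) r _ ⟩
  ∑[ u ∈ p *ₚ q ] ∑[ w ∈ r ] coeffₜ (mulTerm u w) γ              ≡⟨ ∑-*ₚ p q _ ⟩
  ∑[ t ∈ p ] ∑[ s ∈ q ] ∑[ w ∈ r ] coeffₜ (mulTerm (mulTerm t s) w) γ
      ≡⟨ ∑-cong p (λ t → ∑-cong q λ s → ∑-cong r λ w → cong (λ u → coeffₜ u γ) (mulTerm-assoc t s w)) ⟩
  ∑[ t ∈ p ] ∑[ s ∈ q ] ∑[ w ∈ r ] coeffₜ (mulTerm t (mulTerm s w)) γ
      ≡⟨ ∑-cong p (λ t → ∑-*ₚ q r (λ v → coeffₜ (mulTerm t v) γ)) ⟨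
  ∑[ t ∈ p ] ∑[ v ∈ q *ₚ r ] coeffₜ (mulTerm t v) γ              ≡⟨ coeffₘ-* p (q *ₚ r) γ ⟨
  coeffₘ (p *ₚ (q *ₚ r)) γ                                       ∎
  where open ≡-Reasoning

*ₚ-identityˡ : ∀ p → 1ₚ *ₚ p ≋ p
*ₚ-identityˡ p = coeffwise λ γ → begin
  coeffₘ (1ₚ *ₚ p) γ                                   ≡⟨ coeffₘ-* 1ₚ p γ ⟩
  (∑[ s ∈ p ] coeffₜ (mulTerm (1ℤ , 0 , 0 , 0) s) γ) +ℤ 0ℤ ≡⟨ ℤₚ.+-identityʳ _ ⟩
  ∑[ s ∈ p ] coeffₜ (mulTerm (1ℤ , 0 , 0 , 0) s) γ
      ≡⟨ ∑-cong p (λ (c , α) → cong (λ c′ → coeffₜ (c′ , α) γ) (ℤₚ.*-identityˡ c)) ⟩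
  ∑[ s ∈ p ] coeffₜ s γ                                ≡⟨ coeffₘ-∑ p γ ⟨
  coeffₘ p γ                                           ∎
  where open ≡-Reasoning

*ₚ-distribˡ : ∀ p q r → p *ₚ (q +ₚ r) ≋ p *ₚ q +ₚ p *ₚ r
*ₚ-distribˡ p q r = coeffwise λ γ → begin
  coeffₘ (p *ₚ (q +ₚ r)) γ
      ≡⟨ coeffₘ-* p (q +ₚ r) γ ⟩
  ∑[ t ∈ p ] ∑[ s ∈ q +ₚ r ] coeffₜ (mulTerm t s) γ
      ≡⟨ ∑-cong p (λ t → ∑-++ q r _) ⟩
  ∑[ t ∈ p ] ((∑[ s ∈ q ] coeffₜ (mulTerm t s) γ) +ℤ (∑[ s ∈ r ] coeffₜ (mulTerm t s) γ))
      ≡⟨ ∑-+ p _ _ ⟩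
  (∑[ t ∈ p ] ∑[ s ∈ q ] coeffₜ (mulTerm t s) γ) +ℤ (∑[ t ∈ p ] ∑[ s ∈ r ] coeffₜ (mulTerm t s) γ)
      ≡⟨ cong₂ _+ℤ_ (coeffₘ-* p q γ) (coeffₘ-* p r γ) ⟨
  coeffₘ (p *ₚ q) γ +ℤ coeffₘ (p *ₚ r) γ
      ≡⟨ coeffₘ-++ (p *ₚ q) (p *ₚ r) γ ⟨
  coeffₘ (p *ₚ q +ₚ p *ₚ r) γ
      ∎
  where open ≡-Reasoning

shiftedCoeff-cong : ∀ {q q′} → q ≋ q′ → ∀ α γ → shiftedCoeff q α γ ≡ shiftedCoeff q′ α γ
shiftedCoeff-cong q≋q′ α γ = cong (λ c → if does (α ∣ₘ? γ) then c else 0ℤ) (coeff-≡ q≋q′ (γ ⊖ α))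

*ₚ-congˡ : ∀ p {q q′} → q ≋ q′ → p *ₚ q ≋ p *ₚ q′
*ₚ-congˡ p {q} {q′} q≋q′ = coeffwise λ γ →
  coeffₘ-*-shifted p q γ
  ⟨ trans ⟩ ∑-cong p (λ t → cong (scalar t *ℤ_) (shiftedCoeff-cong q≋q′ (monomial t) γ))
  ⟨ trans ⟩ sym (coeffₘ-*-shifted p q′ γ)

*ₚ-cong : ∀ {p p′ q q′} → p ≋ p′ → q ≋ q′ → p *ₚ q ≋ p′ *ₚ q′
*ₚ-cong {p} {p′} {q} {q′} p≋p′ q≋q′ =
  ≋-trans (*ₚ-congˡ p q≋q′) (≋-trans (*ₚ-comm p q′) (≋-trans (*ₚ-congˡ q′ p≋p′) (*ₚ-comm q′ p′)))

Poly-isCommutativeRing : IsCommutativeRing _≋_ _+ₚ_ _*ₚ_ -ₚ_ [] 1ₚ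
Poly-isCommutativeRing = record
  { isRing = record
    { +-isAbelianGroup = record
      { isGroup = record
        { isMonoid = record
          { isSemigroup = record
            { isMagma = record
              { isEquivalence = record { refl = ≋-refl ; sym = ≋-sym ; trans = ≋-trans }
              ; ∙-cong = +ₚ-cong }
            ; assoc = +ₚ-assoc }
          ; identity = (λ p → ≋-refl) , +ₚ-identityʳ }
        ; inverse = -ₚ-inverseˡ , -ₚ-inverseʳ
        ; ⁻¹-cong = -ₚ-cong }
      ; comm = +ₚ-comm }
    ; *-cong = *ₚ-cong
    ; *-assoc = *ₚ-assoc
    ; *-identity = *ₚ-identityˡ , λ p → ≋-trans (*ₚ-comm p 1ₚ) (*ₚ-identityˡ p)
    ; distrib = *ₚ-distribˡ , λ p q r → ≋-trans (*ₚ-comm (q +ₚ r) p)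
        (≋-trans (*ₚ-distribˡ p q r) (+ₚ-cong (*ₚ-comm p q) (*ₚ-comm p r))) }
  ; *-comm = *ₚ-comm }

Poly-commutativeRing : CommutativeRing 0ℓ 0ℓ
Poly-commutativeRing = record { isCommutativeRing = Poly-isCommutativeRing }

open import Data.List.Membership.DecPropositional _≟ₘ_ using (_∈?_)

coeffₘ-∉ : ∀ p {γ} → γ ∉ map monomial p → coeffₘ p γ ≡ 0ℤ
coeffₘ-∉ [] γ∉p = refl
coeffₘ-∉ (t ∷ p) γ∉p =
  cong₂ _+ℤ_ (coeffₜ-≢ t (γ∉p ∘ here ∘ sym)) (coeffₘ-∉ p (γ∉p ∘ there))

coeffₘ-≢0⇒∈ : ∀ p {γ} → coeffₘ p γ ≢ 0ℤ → γ ∈ map monomial p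
coeffₘ-≢0⇒∈ p {γ} pγ≢0 = decidable-stable (γ ∈? map monomial p) (contraposition (coeffₘ-∉ p) pγ≢0)

-- Two polynomials agree everywhere once they agree on the monomials occurring in them.
_≋?_ : ∀ p q → Dec (p ≋ q)
p ≋? q = map′ agree-everywhere (λ p≋q → All.tabulate λ {α} _ → coeff-≡ p≋q α)
  (all? (λ α → coeffₘ p α ℤ.≟ coeffₘ q α) (map monomial p ++ map monomial q))
  where
  agree-everywhere : All (λ α → coeffₘ p α ≡ coeffₘ q α) (map monomial p ++ map monomial q) → p ≋ q
  agree-everywhere agree = coeffwise λ γ → case γ ∈? map monomial p ++ map monomial q of λ where
    (yes γ∈) → All.lookup agree γ∈
    (no γ∉) → trans (coeffₘ-∉ p (γ∉ ∘ ∈-++⁺ˡ)) (sym (coeffₘ-∉ q (γ∉ ∘ ∈-++⁺ʳ (map monomial p))))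

≋-by-evaluation : ∀ {p q} {p≋q : True (p ≋? q)} → p ≋ q
≋-by-evaluation {p≋q = p≋q} = toWitness p≋q

module ≋-Reasoning = SetoidReasoning (CommutativeRing.setoid Poly-commutativeRing)

open import Algebra.Properties.Ring (CommutativeRing.ring Poly-commutativeRing) using (-‿distribʳ-*)
open import Algebra.Properties.Group (CommutativeRing.+-group Poly-commutativeRing)
  using (x∙y⁻¹≈ε⇒x≈y; //-rightDividesˡ; ∙-cancelʳ)

Poly-ring : ACR.AlmostCommutativeRing 0ℓ 0ℓ
Poly-ring = ACR.fromCommutativeRing Poly-commutativeRing (λ p → dec⇒maybe ([] ≋? p))

mono-≡ : ∀ {a b c a′ b′ c′} → a ≡ a′ → b ≡ b′ → c ≡ c′ → mono a b c ≡ mono a′ b′ c′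
mono-≡ refl refl refl = refl

squareVars-++ : ∀ p q → squareVars (p +ₚ q) ≡ squareVars p +ₚ squareVars q
squareVars-++ [] q = refl
squareVars-++ (t ∷ p) q = cong (_ ∷_) (squareVars-++ p q)

squareVars-neg : ∀ p → squareVars (-ₚ p) ≡ -ₚ squareVars p
squareVars-neg [] = refl
squareVars-neg (t ∷ p) = cong (_ ∷_) (squareVars-neg p)

squareVars-* : ∀ p q → squareVars (p *ₚ q) ≡ squareVars p *ₚ squareVars q
squareVars-* [] q = refl
squareVars-* ((c , a , b , d) ∷ p) q = begin
  squareVars (map (mulTerm (c , a , b , d)) q ++ p *ₚ q)
    ≡⟨ squareVars-++ (map (mulTerm (c , a , b , d)) q) (p *ₚ q) ⟩
  squareVars (map (mulTerm (c , a , b , d)) q) ++ squareVars (p *ₚ q)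
    ≡⟨ cong₂ _++_ (squareVars-mulTerm q) (squareVars-* p q) ⟩
  map (mulTerm (c , 2 * a , 2 * b , 2 * d)) (squareVars q) ++ squareVars p *ₚ squareVars q ∎
  where
  open ≡-Reasoning
  squareVars-mulTerm : ∀ q → squareVars (map (mulTerm (c , a , b , d)) q)
                           ≡ map (mulTerm (c , 2 * a , 2 * b , 2 * d)) (squareVars q)
  squareVars-mulTerm [] = refl
  squareVars-mulTerm ((c′ , a′ , b′ , d′) ∷ q) = cong₂ _∷_
    (cong₂ (λ i jk → c *ℤ c′ , i , jk) (ℕₚ.*-distribˡ-+ 2 a a′)
      (cong₂ _,_ (ℕₚ.*-distribˡ-+ 2 b b′) (ℕₚ.*-distribˡ-+ 2 d d′)))
    (squareVars-mulTerm q)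

double : Monomial → Monomial
double (i , j , k) = (2 * i , 2 * j , 2 * k)

double-injective : ∀ {α β} → double α ≡ double β → α ≡ β
double-injective eq = cong₂ _,_ (half (,-injectiveˡ eq))
  (cong₂ _,_ (half (,-injectiveˡ (,-injectiveʳ eq))) (half (,-injectiveʳ (,-injectiveʳ eq))))
  where
  half : ∀ {x y} → 2 * x ≡ 2 * y → x ≡ y
  half {x} {y} = ℕₚ.*-cancelˡ-≡ x y 2

coeffₘ-squareVars : ∀ p γ → coeffₘ (squareVars p) (double γ) ≡ coeffₘ p γ
coeffₘ-squareVars [] γ = refl
coeffₘ-squareVars ((c , α) ∷ p) γ = cong₂ _+ℤ_ coeffₜ-double (coeffₘ-squareVars p γ)
  where
  coeffₜ-double : coeffₜ (c , double α) (double γ) ≡ coeffₜ (c , α) γ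
  coeffₜ-double with α ≟ₘ γ
  ... | yes α≡γ = trans (coeffₜ-≡ (c , double α) (cong double α≡γ)) (sym (coeffₜ-≡ (c , α) α≡γ))
  ... | no α≢γ = trans (coeffₜ-≢ (c , double α) (α≢γ ∘ double-injective)) (sym (coeffₜ-≢ (c , α) α≢γ))

-- Positive polynomials are cancellable

infix 4 _<ₗ_ _≤ₗ_

data _<ₗ_ : Monomial → Monomial → Set where
  <ₗ-first  : ∀ {a b c a′ b′ c′} → a ℕ.< a′ → (a , b , c) <ₗ (a′ , b′ , c′)
  <ₗ-second : ∀ {a b c b′ c′} → b ℕ.< b′ → (a , b , c) <ₗ (a , b′ , c′)
  <ₗ-third  : ∀ {a b c c′} → c ℕ.< c′ → (a , b , c) <ₗ (a , b , c′)

_≤ₗ_ : Monomial → Monomial → Set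
α ≤ₗ β = α ≡ β ⊎ α <ₗ β

<ₗ-irrefl : ∀ {α} → ¬ α <ₗ α
<ₗ-irrefl (<ₗ-first a<a) = ℕₚ.<-irrefl refl a<a
<ₗ-irrefl (<ₗ-second b<b) = ℕₚ.<-irrefl refl b<b
<ₗ-irrefl (<ₗ-third c<c) = ℕₚ.<-irrefl refl c<c

<ₗ-trans : ∀ {α β γ} → α <ₗ β → β <ₗ γ → α <ₗ γ
<ₗ-trans (<ₗ-first p) (<ₗ-first q) = <ₗ-first (ℕₚ.<-trans p q)
<ₗ-trans (<ₗ-first p) (<ₗ-second _) = <ₗ-first p
<ₗ-trans (<ₗ-first p) (<ₗ-third _) = <ₗ-first p
<ₗ-trans (<ₗ-second _) (<ₗ-first q) = <ₗ-first q
<ₗ-trans (<ₗ-second p) (<ₗ-second q) = <ₗ-second (ℕₚ.<-trans p q)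
<ₗ-trans (<ₗ-second p) (<ₗ-third _) = <ₗ-second p
<ₗ-trans (<ₗ-third _) (<ₗ-first q) = <ₗ-first q
<ₗ-trans (<ₗ-third _) (<ₗ-second q) = <ₗ-second q
<ₗ-trans (<ₗ-third p) (<ₗ-third q) = <ₗ-third (ℕₚ.<-trans p q)

≤ₗ-<ₗ-trans : ∀ {α β γ} → α ≤ₗ β → β <ₗ γ → α <ₗ γ
≤ₗ-<ₗ-trans (inj₁ refl) β<γ = β<γ
≤ₗ-<ₗ-trans (inj₂ α<β) β<γ = <ₗ-trans α<β β<γ

<ₗ-≤ₗ-trans : ∀ {α β γ} → α <ₗ β → β ≤ₗ γ → α <ₗ γ
<ₗ-≤ₗ-trans α<β (inj₁ refl) = α<β
<ₗ-≤ₗ-trans α<β (inj₂ β<γ) = <ₗ-trans α<β β<γ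

<ₗ⇒≱ₗ : ∀ {α β} → α <ₗ β → ¬ β ≤ₗ α
<ₗ⇒≱ₗ α<β β≤α = <ₗ-irrefl (≤ₗ-<ₗ-trans β≤α α<β)

<ₗ-cmp : ∀ α β → α <ₗ β ⊎ β ≤ₗ α
<ₗ-cmp (a , b , c) (a′ , b′ , c′) with ℕₚ.<-cmp a a′ | ℕₚ.<-cmp b b′ | ℕₚ.<-cmp c c′
... | tri< a<a′ _ _ | _ | _ = inj₁ (<ₗ-first a<a′)
... | tri> _ _ a′<a | _ | _ = inj₂ (inj₂ (<ₗ-first a′<a))
... | tri≈ _ refl _ | tri< b<b′ _ _ | _ = inj₁ (<ₗ-second b<b′)
... | tri≈ _ refl _ | tri> _ _ b′<b | _ = inj₂ (inj₂ (<ₗ-second b′<b))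
... | tri≈ _ refl _ | tri≈ _ refl _ | tri< c<c′ _ _ = inj₁ (<ₗ-third c<c′)
... | tri≈ _ refl _ | tri≈ _ refl _ | tri≈ _ refl _ = inj₂ (inj₁ refl)
... | tri≈ _ refl _ | tri≈ _ refl _ | tri> _ _ c′<c = inj₂ (inj₂ (<ₗ-third c′<c))

m+n≡o+p⇒m<o⇒p<n : ∀ {m n o p} → m + n ≡ o + p → m ℕ.< o → p ℕ.< n
m+n≡o+p⇒m<o⇒p<n {m} {n} {o} {p} eq m<o =
  ℕₚ.+-cancelˡ-< m p n (ℕₚ.<-≤-trans (ℕₚ.+-monoˡ-< p m<o) (ℕₚ.≤-reflexive (sym eq)))

⊕-<ₗ-cancel : ∀ {α β α′ β′} → α ⊕ β ≡ α′ ⊕ β′ → α <ₗ α′ → β′ <ₗ β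
⊕-<ₗ-cancel eq (<ₗ-first a<a′) = <ₗ-first (m+n≡o+p⇒m<o⇒p<n (,-injectiveˡ eq) a<a′)
⊕-<ₗ-cancel {a , _} {x , _} {_ , _} {x′ , _} eq (<ₗ-second b<b′)
  with refl ← ℕₚ.+-cancelˡ-≡ a x x′ (,-injectiveˡ eq) =
  <ₗ-second (m+n≡o+p⇒m<o⇒p<n (,-injectiveˡ (,-injectiveʳ eq)) b<b′)
⊕-<ₗ-cancel {a , b , _} {x , y , _} {_ , _ , _} {x′ , y′ , _} eq (<ₗ-third c<c′)
  with refl ← ℕₚ.+-cancelˡ-≡ a x x′ (,-injectiveˡ eq)
     | refl ← ℕₚ.+-cancelˡ-≡ b y y′ (,-injectiveˡ (,-injectiveʳ eq)) =
  <ₗ-third (m+n≡o+p⇒m<o⇒p<n (,-injectiveʳ (,-injectiveʳ eq)) c<c′)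

module _ {Q : Monomial → Set} (Q? : ∀ α → Dec (Q α)) where

  LexMaximum : List Monomial → Set
  LexMaximum αs = Σ Monomial λ μ → μ ∈ αs × Q μ × (∀ {α} → α ∈ αs → Q α → α ≤ₗ μ)

  lexMaximum : ∀ αs → (∀ {α} → α ∈ αs → ¬ Q α) ⊎ LexMaximum αs
  lexMaximum [] = inj₁ λ ()
  lexMaximum (α ∷ αs) with Q? α | lexMaximum αs
  ... | no ¬Qα | inj₁ none = inj₁ λ { (here refl) → ¬Qα ; (there α∈) → none α∈ }
  ... | no ¬Qα | inj₂ (μ , μ∈ , Qμ , max) =
    inj₂ (μ , there μ∈ , Qμ , λ { (here refl) Qα → ⊥-elim (¬Qα Qα) ; (there β∈) → max β∈ })
  ... | yes Qα | inj₁ none =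
    inj₂ (α , here refl , Qα , λ { (here refl) _ → inj₁ refl ; (there β∈) Qβ → ⊥-elim (none β∈ Qβ) })
  ... | yes Qα | inj₂ (μ , μ∈ , Qμ , max) with <ₗ-cmp α μ
  ...   | inj₁ α<μ = inj₂ (μ , there μ∈ , Qμ , λ { (here refl) _ → inj₂ α<μ ; (there β∈) → max β∈ })
  ...   | inj₂ μ≤α = inj₂ (α , here refl , Qα , λ
          { (here refl) _ → inj₁ refl
          ; (there β∈) Qβ → case max β∈ Qβ of λ where
              (inj₁ refl) → μ≤α
              (inj₂ β<μ) → inj₂ (<ₗ-≤ₗ-trans β<μ μ≤α) })

coeffₘ-*-leading : ∀ D E {δ β} →
                   (∀ {t} → t ∈ D → monomial t ≤ₗ δ) → (∀ {α} → coeffₘ E α ≢ 0ℤ → α ≤ₗ β) →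
                   coeffₘ (D *ₚ E) (δ ⊕ β) ≡ coeffₘ D δ *ℤ coeffₘ E β
coeffₘ-*-leading D E {δ} {β} D≤δ E≤β = begin
  coeffₘ (D *ₚ E) (δ ⊕ β)                                    ≡⟨ coeffₘ-*-shifted D E (δ ⊕ β) ⟩
  ∑[ t ∈ D ] scalar t *ℤ shiftedCoeff E (monomial t) (δ ⊕ β) ≡⟨ ∑-cong-∈ D (λ t∈D → termwise (D≤δ t∈D)) ⟩
  ∑[ t ∈ D ] coeffₜ t δ *ℤ coeffₘ E β                        ≡⟨ ∑-*ʳ D (coeffₘ E β) (λ t → coeffₜ t δ) ⟩
  (∑[ t ∈ D ] coeffₜ t δ) *ℤ coeffₘ E β                      ≡⟨ cong (_*ℤ coeffₘ E β) (coeffₘ-∑ D δ) ⟨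
  coeffₘ D δ *ℤ coeffₘ E β                                   ∎
  where
  open ≡-Reasoning
  vanishes-above : ∀ {α} → β <ₗ α → coeffₘ E α ≡ 0ℤ
  vanishes-above {α} β<α with coeffₘ E α ℤ.≟ 0ℤ
  ... | yes Eα≡0 = Eα≡0
  ... | no Eα≢0 = ⊥-elim (<ₗ⇒≱ₗ β<α (E≤β Eα≢0))
  shifted-below : ∀ {α} → α <ₗ δ → shiftedCoeff E α (δ ⊕ β) ≡ 0ℤ
  shifted-below {α} α<δ with α ∣ₘ? δ ⊕ β
  ... | no α∤ = shiftedCoeff-∤ E α∤
  ... | yes α∣ = trans (shiftedCoeff-∣ E α∣) (vanishes-above (⊕-<ₗ-cancel (α⊕[γ⊖α]≡γ α∣) α<δ))
  termwise : ∀ {t} → monomial t ≤ₗ δ →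
             scalar t *ℤ shiftedCoeff E (monomial t) (δ ⊕ β) ≡ coeffₜ t δ *ℤ coeffₘ E β
  termwise {t} (inj₁ refl) = cong₂ _*ℤ_ (sym (coeffₜ-≡ t refl))
    (trans (shiftedCoeff-∣ E (α∣ₘα⊕β δ β)) (cong (coeffₘ E) ([α⊕β]⊖α≡β δ β)))
  termwise {t} (inj₂ α<δ) = begin
    scalar t *ℤ shiftedCoeff E (monomial t) (δ ⊕ β) ≡⟨ cong (scalar t *ℤ_) (shifted-below α<δ) ⟩
    scalar t *ℤ 0ℤ                                 ≡⟨ ℤₚ.*-zeroʳ (scalar t) ⟩
    0ℤ                                             ≡⟨ ℤₚ.*-zeroˡ (coeffₘ E β) ⟨
    0ℤ *ℤ coeffₘ E β                               ≡⟨ cong (_*ℤ coeffₘ E β) (coeffₜ-≢ t λ { refl → <ₗ-irrefl α<δ }) ⟨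
    coeffₜ t δ *ℤ coeffₘ E β                       ∎

PositiveTerm : Term → Set
PositiveTerm (c , _) = Σ ℕ λ n → c ≡ +[1+ n ]

Positive : Poly → Set
Positive [] = ⊥
Positive (t ∷ p) = All PositiveTerm (t ∷ p)

Positive⇒All : ∀ {p} → Positive p → All PositiveTerm p
Positive⇒All {t ∷ p} pos = pos

coeffₜ-nonNegative : ∀ {t} → PositiveTerm t → ∀ γ → Σ ℕ λ n → coeffₜ t γ ≡ + n
coeffₜ-nonNegative {t} (m , c≡1+m) γ with monomial t ≟ₘ γ
... | yes α≡γ = suc m , trans (coeffₜ-≡ t α≡γ) c≡1+m
... | no α≢γ = 0 , coeffₜ-≢ t α≢γ

coeffₘ-nonNegative : ∀ {p} → All PositiveTerm p → ∀ γ → Σ ℕ λ n → coeffₘ p γ ≡ + n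
coeffₘ-nonNegative All.[] γ = 0 , refl
coeffₘ-nonNegative {t ∷ p} (post All.∷ pos) γ with coeffₜ-nonNegative {t} post γ | coeffₘ-nonNegative pos γ
... | m , eqₜ | n , eq = m + n , cong₂ _+ℤ_ eqₜ eq

coeffₘ-positive : ∀ {p γ} → All PositiveTerm p → γ ∈ map monomial p → Σ ℕ λ n → coeffₘ p γ ≡ +[1+ n ]
coeffₘ-positive {t ∷ p} {γ} ((m , c≡1+m) All.∷ pos) (here γ≡α) with coeffₘ-nonNegative pos γ
... | n , eq = m + n , cong₂ _+ℤ_ (trans (coeffₜ-≡ t (sym γ≡α)) c≡1+m) eq
coeffₘ-positive {t ∷ p} {γ} (post All.∷ pos) (there γ∈p) with coeffₜ-nonNegative {t} post γ | coeffₘ-positive pos γ∈p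
... | m , eqₜ | n , eq = m + n , trans (cong₂ _+ℤ_ eqₜ eq) (cong +_ (ℕₚ.+-suc m n))

lexLargestTerm : ∀ {D} → Positive D → Σ Monomial λ δ → δ ∈ map monomial D × (∀ {t} → t ∈ D → monomial t ≤ₗ δ)
lexLargestTerm {t ∷ D} _ with lexMaximum (λ _ → yes tt) (map monomial (t ∷ D))
... | inj₁ noTerms = ⊥-elim (noTerms (here refl) tt)
... | inj₂ (δ , δ∈D , _ , D≤δ) = δ , δ∈D , λ t∈D → D≤δ (∈-map⁺ monomial t∈D) tt

positive-noZeroDivisor : ∀ {D} → Positive D → ∀ {E} → D *ₚ E ≋ [] → ∀ γ → coeffₘ E γ ≡ 0ℤ
positive-noZeroDivisor {D} posD {E} DE≋0 γ with coeffₘ E γ ℤ.≟ 0ℤ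
... | yes Eγ≡0 = Eγ≡0
... | no Eγ≢0 with lexLargestTerm posD | lexMaximum (λ α → ¬? (coeffₘ E α ℤ.≟ 0ℤ)) (map monomial E)
...   | _ | inj₁ vanishes = ⊥-elim (vanishes (coeffₘ-≢0⇒∈ E Eγ≢0) Eγ≢0)
...   | δ , δ∈D , D≤δ | inj₂ (β , _ , Eβ≢0 , E≤β) =
  ⊥-elim ([ Dδ≢0 , Eβ≢0 ]′ (ℤₚ.i*j≡0⇒i≡0∨j≡0 (coeffₘ D δ) leading≡0))
  where
  Dδ≢0 : coeffₘ D δ ≢ 0ℤ
  Dδ≢0 Dδ≡0 with coeffₘ-positive (Positive⇒All posD) δ∈D
  ... | n , Dδ≡1+n = case trans (sym Dδ≡1+n) Dδ≡0 of λ ()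
  leading≡0 : coeffₘ D δ *ℤ coeffₘ E β ≡ 0ℤ
  leading≡0 = trans (sym (coeffₘ-*-leading D E D≤δ (λ Eα≢0 → E≤β (coeffₘ-≢0⇒∈ E Eα≢0) Eα≢0)))
                    (coeff-≡ DE≋0 (δ ⊕ β))

*ₚ-cancelˡ-positive : ∀ {D} → Positive D → ∀ {A B} → D *ₚ A ≋ D *ₚ B → A ≋ B
*ₚ-cancelˡ-positive {D} posD {A} {B} DA≋DB =
  x∙y⁻¹≈ε⇒x≈y A B (coeffwise (positive-noZeroDivisor posD D[A-B]≋0))
  where
  open ≋-Reasoning
  D[A-B]≋0 : D *ₚ (A +ₚ -ₚ B) ≋ []
  D[A-B]≋0 = begin
    D *ₚ (A +ₚ -ₚ B)        ≈⟨ *ₚ-distribˡ D A (-ₚ B) ⟩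
    D *ₚ A +ₚ D *ₚ -ₚ B     ≈⟨ +ₚ-cong DA≋DB (≋-sym (-‿distribʳ-* D B)) ⟩
    D *ₚ B +ₚ -ₚ (D *ₚ B)   ≈⟨ -ₚ-inverseʳ (D *ₚ B) ⟩
    []                      ∎

mulTerm-positive : ∀ {t s} → PositiveTerm t → PositiveTerm s → PositiveTerm (mulTerm t s)
mulTerm-positive {_ , _} {_ , _} (m , refl) (n , refl) = _ , refl

*ₚ-allPositive : ∀ {p q} → All PositiveTerm p → All PositiveTerm q → All PositiveTerm (p *ₚ q)
*ₚ-allPositive All.[] posq = All.[]
*ₚ-allPositive {t ∷ p} {q} (post All.∷ posp) posq =
  All.++⁺ (All.map⁺ {xs = q} (All.map (λ {s} → mulTerm-positive {t} {s} post) posq)) (*ₚ-allPositive posp posq)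

*ₚ-positive : ∀ {p q} → Positive p → Positive q → Positive (p *ₚ q)
*ₚ-positive {_ ∷ _} {_ ∷ _} = *ₚ-allPositive

+ₚ-positive : ∀ {p q} → Positive p → Positive q → Positive (p +ₚ q)
+ₚ-positive {_ ∷ _} {_ ∷ _} posp posq = All.++⁺ posp posq

PositiveFrac : Frac → Set
PositiveFrac F = Positive (num F) × Positive (den F)

sqsumDiv-positive : ∀ {A B C} → PositiveFrac A → PositiveFrac B → PositiveFrac C → PositiveFrac (sqsumDiv A B C)
sqsumDiv-positive (a , a′) (b , b′) (c , c′) =
  *ₚ (+ₚ-positive (*ₚ (*ₚ (*ₚ a a) b′) b′) (*ₚ (*ₚ (*ₚ b b) a′) a′)) c′ ,
  *ₚ (*ₚ (*ₚ (*ₚ a′ a′) b′) b′) c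
  where
  *ₚ = *ₚ-positive

mono-positive : ∀ a b c → Positive (mono a b c)
mono-positive a b c = (0 , refl) All.∷ All.[]

-- The Stern–Brocot tree

Fraction : Set
Fraction = ℕ × ℕ

infix 4 _<ᶠ_
infixl 6 _⊞_

-- a/b < c/d, cross-multiplied; a record so that the two fractions can be inferred from a proof.
record _<ᶠ_ (x y : Fraction) : Set where
  constructor cross<
  field cross : proj₁ x * proj₂ y ℕ.< proj₁ y * proj₂ x

_⊞_ : Fraction → Fraction → Fraction
(a , b) ⊞ (c , d) = (a + c , b + d)

<ᶠ-irrefl : ∀ {x} → ¬ x <ᶠ x
<ᶠ-irrefl (cross< x<x) = ℕₚ.<-irrefl refl x<x

<ᶠ-asym : ∀ {x y} → x <ᶠ y → ¬ y <ᶠ x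
<ᶠ-asym (cross< x<y) (cross< y<x) = ℕₚ.<-asym x<y y<x

<ᶠ-mediantˡ : ∀ {x y} → x <ᶠ y → x <ᶠ x ⊞ y
<ᶠ-mediantˡ {a , b} {c , d} (cross< ad<cb) = cross< $ begin-strict
  a * (b + d)   ≡⟨ ℕₚ.*-distribˡ-+ a b d ⟩
  a * b + a * d <⟨ ℕₚ.+-monoʳ-< (a * b) ad<cb ⟩
  a * b + c * b ≡⟨ ℕₚ.*-distribʳ-+ b a c ⟨
  (a + c) * b   ∎
  where open ℕₚ.≤-Reasoning

<ᶠ-mediantʳ : ∀ {x y} → x <ᶠ y → x ⊞ y <ᶠ y
<ᶠ-mediantʳ {a , b} {c , d} (cross< ad<cb) = cross< $ begin-strict
  (a + c) * d   ≡⟨ ℕₚ.*-distribʳ-+ d a c ⟩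
  a * d + c * d <⟨ ℕₚ.+-monoˡ-< (c * d) ad<cb ⟩
  c * b + c * d ≡⟨ ℕₚ.*-distribˡ-+ c b d ⟨
  c * (b + d)   ∎
  where open ℕₚ.≤-Reasoning

<ᶠ-⊞-trans : ∀ {x y m} → x <ᶠ m → m <ᶠ x ⊞ y → m <ᶠ y
<ᶠ-⊞-trans {a , b} {c , d} {e , f} (cross< af<eb) (cross< e[b+d]<[a+c]f) =
  cross< $ ℕₚ.+-cancelˡ-< (e * b) (e * d) (c * f) $ begin-strict
  e * b + e * d ≡⟨ ℕₚ.*-distribˡ-+ e b d ⟨
  e * (b + d)   <⟨ e[b+d]<[a+c]f ⟩
  (a + c) * f   ≡⟨ ℕₚ.*-distribʳ-+ f a c ⟩
  a * f + c * f ≤⟨ ℕₚ.+-monoˡ-≤ (c * f) (ℕₚ.<⇒≤ af<eb) ⟩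
  e * b + c * f ∎
  where open ℕₚ.≤-Reasoning

⊞-<ᶠ-trans : ∀ {x y m} → x ⊞ y <ᶠ m → m <ᶠ y → x <ᶠ m
⊞-<ᶠ-trans {a , b} {c , d} {e , f} (cross< [a+c]f<e[b+d]) (cross< ed<cf) =
  cross< $ ℕₚ.+-cancelʳ-< (c * f) (a * f) (e * b) $ begin-strict
  a * f + c * f ≡⟨ ℕₚ.*-distribʳ-+ f a c ⟨
  (a + c) * f   <⟨ [a+c]f<e[b+d] ⟩
  e * (b + d)   ≡⟨ ℕₚ.*-distribˡ-+ e b d ⟩
  e * b + e * d ≤⟨ ℕₚ.+-monoʳ-≤ (e * b) (ℕₚ.<⇒≤ ed<cf) ⟩
  e * b + c * f ∎
  where open ℕₚ.≤-Reasoning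

leftEnd rightEnd mediant : Node → Fraction
leftEnd nd = p nd , q nd
rightEnd nd = r nd , s nd
mediant nd = medNum nd , medDen nd

descend : List Dir → Node → Node
descend [] nd = nd
descend (d ∷ ds) nd = descend ds (step d nd)

-- `nodeAt` recurses through a local helper that cannot be named from outside Defs; the meta
-- below is solved by unification with that helper, which lets us relate `nodeAt` to `descend`.
mutual
  nodeAtFrom : List Dir → List Dir → Node → Node
  nodeAtFrom = _

  nodeAt-∷ : ∀ d ds → nodeAt (d ∷ ds) ≡ nodeAtFrom (d ∷ ds) ds (step d root)
  nodeAt-∷ d ds with d ∷ ds | step d root
  ... | _ | _ = refl

nodeAtFrom≡descend : ∀ xs ds nd → nodeAtFrom xs ds nd ≡ descend ds nd
nodeAtFrom≡descend xs [] nd = refl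
nodeAtFrom≡descend xs (d ∷ ds) nd = nodeAtFrom≡descend xs ds (step d nd)

nodeAt≡descend : ∀ ds → nodeAt ds ≡ descend ds root
nodeAt≡descend [] = refl
nodeAt≡descend (d ∷ ds) = trans (nodeAt-∷ d ds) (nodeAtFrom≡descend (d ∷ ds) ds (step d root))

Ordered : Node → Set
Ordered nd = leftEnd nd <ᶠ rightEnd nd

step-ordered : ∀ d nd → Ordered nd → Ordered (step d nd)
step-ordered L nd = <ᶠ-mediantˡ
step-ordered R nd = <ᶠ-mediantʳ

descend-between : ∀ ds nd → Ordered nd →
                  leftEnd nd <ᶠ mediant (descend ds nd) × mediant (descend ds nd) <ᶠ rightEnd nd
descend-between [] nd ord = <ᶠ-mediantˡ ord , <ᶠ-mediantʳ ord
descend-between (L ∷ ds) nd ord with descend-between ds (step L nd) (step-ordered L nd ord)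
... | l<m , m<μ = l<m , <ᶠ-⊞-trans l<m m<μ
descend-between (R ∷ ds) nd ord with descend-between ds (step R nd) (step-ordered R nd ord)
... | μ<m , m<r = ⊞-<ᶠ-trans μ<m m<r , m<r

Side : Dir → Fraction → Fraction → Set
Side L m μ = m <ᶠ μ
Side R m μ = μ <ᶠ m

side-irrefl : ∀ d {μ} → ¬ Side d μ μ
side-irrefl L = <ᶠ-irrefl
side-irrefl R = <ᶠ-irrefl

child-side : ∀ d ds nd → Ordered nd → Side d (mediant (descend ds (step d nd))) (mediant nd)
child-side L ds nd ord = proj₂ (descend-between ds (step L nd) (step-ordered L nd ord))
child-side R ds nd ord = proj₁ (descend-between ds (step R nd) (step-ordered R nd ord))

descend-injective : ∀ nd → Ordered nd → ∀ ds ds′ → mediant (descend ds nd) ≡ mediant (descend ds′ nd) → ds ≡ ds′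
descend-injective nd ord [] [] eq = refl
descend-injective nd ord [] (d ∷ ds′) eq =
  ⊥-elim (side-irrefl d (subst (λ m → Side d m (mediant nd)) (sym eq) (child-side d ds′ nd ord)))
descend-injective nd ord (d ∷ ds) [] eq =
  ⊥-elim (side-irrefl d (subst (λ m → Side d m (mediant nd)) eq (child-side d ds nd ord)))
descend-injective nd ord (L ∷ ds) (R ∷ ds′) eq =
  ⊥-elim (<ᶠ-asym (child-side L ds nd ord) (subst (mediant nd <ᶠ_) (sym eq) (child-side R ds′ nd ord)))
descend-injective nd ord (R ∷ ds) (L ∷ ds′) eq =
  ⊥-elim (<ᶠ-asym (child-side R ds nd ord) (subst (_<ᶠ mediant nd) (sym eq) (child-side L ds′ nd ord)))
descend-injective nd ord (L ∷ ds) (L ∷ ds′) eq =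
  cong (L ∷_) (descend-injective (step L nd) (step-ordered L nd ord) ds ds′ eq)
descend-injective nd ord (R ∷ ds) (R ∷ ds′) eq =
  cong (R ∷_) (descend-injective (step R nd) (step-ordered R nd ord) ds ds′ eq)

-- Markov polynomials along the path to n/(n+1)

-- For a recurrence A = tB − mC, the defect AC − B² is multiplied by m at every step.
cassini-step : ∀ {t m c A B C A′ K} →
  A +ₚ m *ₚ C ≋ t *ₚ B → A′ +ₚ m *ₚ B ≋ t *ₚ A → A *ₚ C ≋ B *ₚ B +ₚ c *ₚ K →
  A′ *ₚ B ≋ A *ₚ A +ₚ c *ₚ (m *ₚ K)
cassini-step {t} {m} {c} {A} {B} {C} {A′} {K} recA recA′ AC≋ =
  ∙-cancelʳ (m *ₚ (B *ₚ B)) (A′ *ₚ B) (A *ₚ A +ₚ c *ₚ (m *ₚ K)) (begin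
  A′ *ₚ B +ₚ m *ₚ (B *ₚ B)           ≈⟨ solve (A′ ∷ B ∷ m ∷ []) Poly-ring ⟩
  (A′ +ₚ m *ₚ B) *ₚ B                ≈⟨ *ₚ-cong recA′ ≋-refl ⟩
  t *ₚ A *ₚ B                         ≈⟨ solve (t ∷ A ∷ B ∷ []) Poly-ring ⟩
  A *ₚ (t *ₚ B)                       ≈⟨ *ₚ-congˡ A (≋-sym recA) ⟩
  A *ₚ (A +ₚ m *ₚ C)                 ≈⟨ solve (A ∷ m ∷ C ∷ []) Poly-ring ⟩
  A *ₚ A +ₚ m *ₚ (A *ₚ C)            ≈⟨ +ₚ-cong ≋-refl (*ₚ-congˡ m AC≋) ⟩
  A *ₚ A +ₚ m *ₚ (B *ₚ B +ₚ c *ₚ K)  ≈⟨ solve (A ∷ m ∷ B ∷ c ∷ K ∷ []) Poly-ring ⟩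
  A *ₚ A +ₚ c *ₚ (m *ₚ K) +ₚ m *ₚ (B *ₚ B) ∎)
  where open ≋-Reasoning

record Expansion (F : Frac) (P D : Poly) : Set where
  field
    factor : Poly
    num≋ : num F ≋ P *ₚ factor
    den≋ : den F ≋ D *ₚ factor

expansion-cross : ∀ {F P D} → Expansion F P D → num F *ₚ D ≋ den F *ₚ P
expansion-cross {F} {P} {D} record { factor = E ; num≋ = num≋ ; den≋ = den≋ } = begin
  num F *ₚ D   ≈⟨ *ₚ-cong num≋ ≋-refl ⟩
  P *ₚ E *ₚ D  ≈⟨ solve (P ∷ E ∷ D ∷ []) Poly-ring ⟩
  D *ₚ E *ₚ P  ≈⟨ *ₚ-cong (≋-sym den≋) ≋-refl ⟩
  den F *ₚ P   ∎
  where open ≋-Reasoning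

sqsumDiv-expansion : ∀ {a a′ c c′ Pa Da Pc Dc Pn Dn} b b′ ρ κ →
  Expansion (a /ₚ a′) Pa Da → Expansion (c /ₚ c′) Pc Dc →
  b′ *ₚ b′ *ₚ Dc ≋ ρ → Da *ₚ Da *ₚ Dc ≋ κ *ₚ ρ → Da *ₚ Da *ₚ b′ *ₚ b′ ≋ Dn *ₚ ρ →
  Pn *ₚ Pc ≋ Pa *ₚ Pa +ₚ b *ₚ b *ₚ κ →
  Expansion (sqsumDiv (a /ₚ a′) (b /ₚ b′) (c /ₚ c′)) Pn Dn
sqsumDiv-expansion {a} {a′} {c} {c′} {Pa} {Da} {Pc} {Dc} {Pn} {Dn} b b′ ρ κ
  record { factor = E ; num≋ = a≋ ; den≋ = a′≋ } record { factor = G ; num≋ = c≋ ; den≋ = c′≋ }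
  b′b′Dc≋ DaDaDc≋ DaDab′b′≋ PnPc≋ = record { factor = ρ *ₚ Pc *ₚ E *ₚ E *ₚ G ; num≋ = num≋ ; den≋ = den≋ }
  where
  open ≋-Reasoning
  num≋ : (a *ₚ a *ₚ b′ *ₚ b′ +ₚ b *ₚ b *ₚ a′ *ₚ a′) *ₚ c′ ≋ Pn *ₚ (ρ *ₚ Pc *ₚ E *ₚ E *ₚ G)
  num≋ = begin
    (a *ₚ a *ₚ b′ *ₚ b′ +ₚ b *ₚ b *ₚ a′ *ₚ a′) *ₚ c′
      ≈⟨ *ₚ-cong (+ₚ-cong (*ₚ-cong (*ₚ-cong (*ₚ-cong a≋ a≋) ≋-refl) ≋-refl) (*ₚ-cong (*ₚ-congˡ (b *ₚ b) a′≋) a′≋)) c′≋ ⟩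
    (Pa *ₚ E *ₚ (Pa *ₚ E) *ₚ b′ *ₚ b′ +ₚ b *ₚ b *ₚ (Da *ₚ E) *ₚ (Da *ₚ E)) *ₚ (Dc *ₚ G)
      ≈⟨ solve (Pa ∷ E ∷ b′ ∷ b ∷ Da ∷ Dc ∷ G ∷ []) Poly-ring ⟩
    (Pa *ₚ Pa *ₚ (b′ *ₚ b′ *ₚ Dc) +ₚ b *ₚ b *ₚ (Da *ₚ Da *ₚ Dc)) *ₚ (E *ₚ E *ₚ G)
      ≈⟨ *ₚ-cong (+ₚ-cong (*ₚ-congˡ (Pa *ₚ Pa) b′b′Dc≋) (*ₚ-congˡ (b *ₚ b) DaDaDc≋)) ≋-refl ⟩
    (Pa *ₚ Pa *ₚ ρ +ₚ b *ₚ b *ₚ (κ *ₚ ρ)) *ₚ (E *ₚ E *ₚ G)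
      ≈⟨ solve (Pa ∷ ρ ∷ b ∷ κ ∷ E ∷ G ∷ []) Poly-ring ⟩
    (Pa *ₚ Pa +ₚ b *ₚ b *ₚ κ) *ₚ (ρ *ₚ E *ₚ E *ₚ G)
      ≈⟨ *ₚ-cong (≋-sym PnPc≋) ≋-refl ⟩
    Pn *ₚ Pc *ₚ (ρ *ₚ E *ₚ E *ₚ G)
      ≈⟨ solve (Pn ∷ Pc ∷ ρ ∷ E ∷ G ∷ []) Poly-ring ⟩
    Pn *ₚ (ρ *ₚ Pc *ₚ E *ₚ E *ₚ G) ∎
  den≋ : a′ *ₚ a′ *ₚ b′ *ₚ b′ *ₚ c ≋ Dn *ₚ (ρ *ₚ Pc *ₚ E *ₚ E *ₚ G)
  den≋ = begin
    a′ *ₚ a′ *ₚ b′ *ₚ b′ *ₚ c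
      ≈⟨ *ₚ-cong (*ₚ-cong (*ₚ-cong (*ₚ-cong a′≋ a′≋) ≋-refl) ≋-refl) c≋ ⟩
    Da *ₚ E *ₚ (Da *ₚ E) *ₚ b′ *ₚ b′ *ₚ (Pc *ₚ G)
      ≈⟨ solve (Da ∷ E ∷ b′ ∷ Pc ∷ G ∷ []) Poly-ring ⟩
    Da *ₚ Da *ₚ b′ *ₚ b′ *ₚ (Pc *ₚ E *ₚ E *ₚ G)
      ≈⟨ *ₚ-cong DaDab′b′≋ ≋-refl ⟩
    Dn *ₚ ρ *ₚ (Pc *ₚ E *ₚ E *ₚ G)
      ≈⟨ solve (Dn ∷ ρ ∷ Pc ∷ E ∷ G ∷ []) Poly-ring ⟩
    Dn *ₚ (ρ *ₚ Pc *ₚ E *ₚ E *ₚ G) ∎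

M₁₁ : Frac
M₁₁ = (X *ₚ X +ₚ Y *ₚ Y) /ₚ Z

-- markov k = M_{k/(k+1)}
markov : ℕ → Frac
markov 0 = X /ₚ 1ₚ
markov 1 = sqsumDiv (markov 0) M₁₁ (Y /ₚ 1ₚ)
markov (suc (suc k)) = sqsumDiv (markov (suc k)) M₁₁ (markov k)

pathNode : ℕ → Node
pathNode k = node k (suc k) 1 1 (markov k) (markov (suc k)) M₁₁

pathTo : ℕ → List Dir
pathTo n = L ∷ replicate (n ∸ 1) R

step-R-pathNode : ∀ k → step R (pathNode k) ≡ pathNode (suc k)
step-R-pathNode k = cong₂ (λ a b → node a b 1 1 (markov (suc k)) (markov (suc (suc k))) M₁₁)
  (ℕₚ.+-comm k 1) (cong suc (ℕₚ.+-comm k 1))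

descend-R-pathNode : ∀ m k → descend (replicate m R) (pathNode k) ≡ pathNode (m + k)
descend-R-pathNode zero k = refl
descend-R-pathNode (suc m) k = begin
  descend (replicate m R) (step R (pathNode k)) ≡⟨ cong (descend (replicate m R)) (step-R-pathNode k) ⟩
  descend (replicate m R) (pathNode (suc k))    ≡⟨ descend-R-pathNode m (suc k) ⟩
  pathNode (m + suc k)                          ≡⟨ cong pathNode (ℕₚ.+-suc m k) ⟩
  pathNode (suc m + k)                          ∎
  where open ≡-Reasoning

nodeAt-pathTo : ∀ k → nodeAt (pathTo (suc k)) ≡ pathNode k
nodeAt-pathTo k = trans (nodeAt≡descend (pathTo (suc k)))
  (trans (descend-R-pathNode k 0) (cong pathNode (ℕₚ.+-identityʳ k)))

mediant-pathNode : ∀ k → mediant (pathNode k) ≡ (suc k , suc (suc k))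
mediant-pathNode k = cong₂ _,_ (ℕₚ.+-comm k 1) (cong suc (ℕₚ.+-comm k 1))

mediant-pathTo : ∀ j → mediant (nodeAt (pathTo (suc j))) ≡ (suc j , suc (suc j))
mediant-pathTo j = trans (cong mediant (nodeAt-pathTo j)) (mediant-pathNode j)

nodeAt-mediant : ∀ k ds → mediant (nodeAt ds) ≡ (suc k , suc (suc k)) → nodeAt ds ≡ pathNode k
nodeAt-mediant k ds mediant≡ = begin
  nodeAt ds                ≡⟨ cong nodeAt ds≡pathTo ⟩
  nodeAt (pathTo (suc k))  ≡⟨ nodeAt-pathTo k ⟩
  pathNode k               ∎
  where
  open ≡-Reasoning
  ds≡pathTo : ds ≡ pathTo (suc k)
  ds≡pathTo = descend-injective root (cross< (ℕₚ.n<1+n 0)) ds (pathTo (suc k)) (begin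
    mediant (descend ds root)                ≡⟨ cong mediant (nodeAt≡descend ds) ⟨
    mediant (nodeAt ds)                      ≡⟨ mediant≡ ⟩
    (suc k , suc (suc k))                    ≡⟨ mediant-pathTo k ⟨
    mediant (nodeAt (pathTo (suc k)))        ≡⟨ cong mediant (nodeAt≡descend (pathTo (suc k))) ⟩
    mediant (descend (pathTo (suc k)) root)  ∎)

M₁₁-positive : PositiveFrac M₁₁
M₁₁-positive = +ₚ-positive (*ₚ-positive (mono-positive 1 0 0) (mono-positive 1 0 0))
                           (*ₚ-positive (mono-positive 0 1 0) (mono-positive 0 1 0))
             , mono-positive 0 0 1

markov-positive : ∀ k → PositiveFrac (markov k)
markov-positive 0 = mono-positive 1 0 0 , mono-positive 0 0 0
markov-positive 1 = sqsumDiv-positive (markov-positive 0) M₁₁-positive (mono-positive 0 1 0 , mono-positive 0 0 0)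
markov-positive (suc (suc k)) = sqsumDiv-positive (markov-positive (suc k)) M₁₁-positive (markov-positive k)

u v w : Poly
u = X
v = Y
w = Z

T uvw² : Poly
T = (u +ₚ v) *ₚ (u +ₚ v +ₚ w)
uvw² = u *ₚ v *ₚ w *ₚ w

-- numerator k = P_{k/(k+1)}(u, v, w)
numerator : ℕ → Poly
numerator 0 = 1ₚ
numerator 1 = u *ₚ w +ₚ (u +ₚ v) *ₚ (u +ₚ v)
numerator (suc (suc k)) = T *ₚ numerator (suc k) +ₚ -ₚ (uvw² *ₚ numerator k)

S : ℕ → Poly
S k = squareVars (numerator k)

S-recurrence : ∀ k → S (suc (suc k)) +ₚ squareVars uvw² *ₚ S k ≋ squareVars T *ₚ S (suc k)
S-recurrence k = begin
  S (suc (suc k)) +ₚ squareVars uvw² *ₚ S k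
    ≡⟨ cong (_+ₚ squareVars uvw² *ₚ S k) squareVars-rec ⟩
  squareVars T *ₚ S (suc k) +ₚ -ₚ (squareVars uvw² *ₚ S k) +ₚ squareVars uvw² *ₚ S k
    ≈⟨ //-rightDividesˡ (squareVars uvw² *ₚ S k) (squareVars T *ₚ S (suc k)) ⟩
  squareVars T *ₚ S (suc k) ∎
  where
  open ≋-Reasoning
  squareVars-rec : S (suc (suc k)) ≡ squareVars T *ₚ S (suc k) +ₚ -ₚ (squareVars uvw² *ₚ S k)
  squareVars-rec = trans (squareVars-++ (T *ₚ numerator (suc k)) (-ₚ (uvw² *ₚ numerator k)))
    (cong₂ _+ₚ_ (squareVars-* T (numerator (suc k)))
                (trans (squareVars-neg (uvw² *ₚ numerator k)) (cong -ₚ_ (squareVars-* uvw² (numerator k)))))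

κ : ℕ → Poly
κ zero = Y *ₚ Y *ₚ (Z *ₚ Z)
κ (suc k) = squareVars uvw² *ₚ κ k

κ-mono : ∀ k → κ k ≡ mono (k * 2) (2 + k * 2) (2 + k * 4)
κ-mono zero = refl
κ-mono (suc k) = cong (squareVars uvw² *ₚ_) (κ-mono k)

cassini : ∀ k → S (2 + k) *ₚ S k ≋ S (1 + k) *ₚ S (1 + k) +ₚ num M₁₁ *ₚ num M₁₁ *ₚ κ k
cassini zero = ≋-by-evaluation
cassini (suc k) =
  cassini-step {squareVars T} {squareVars uvw²} {num M₁₁ *ₚ num M₁₁} {S (2 + k)} {S (1 + k)} {S k} {S (3 + k)} {κ k}
    (S-recurrence k) (S-recurrence (suc k)) (cassini k)

-- x^(n−1) yⁿ z²ⁿ for n = j + 1, in the form that `IsNumerator` reduces to.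
denominator : ℕ → Poly
denominator j = mono j (suc j) (j + suc (suc j))

denominator²-z² : ∀ k → denominator (1 + k) *ₚ denominator (1 + k) *ₚ Z *ₚ Z
                       ≡ denominator (2 + k) *ₚ (Z *ₚ Z *ₚ denominator k)
denominator²-z² k = mono-≡ (x k) (y k) (z k)
  where
  x : ∀ k → (1 + k) + (1 + k) + 0 + 0 ≡ (2 + k) + (0 + 0 + k)
  x = ℕ-Solver.solve-∀
  y : ∀ k → suc (1 + k) + suc (1 + k) + 0 + 0 ≡ suc (2 + k) + (0 + 0 + suc k)
  y = ℕ-Solver.solve-∀
  z : ∀ k → ((1 + k) + suc (suc (1 + k))) + ((1 + k) + suc (suc (1 + k))) + 1 + 1
          ≡ ((2 + k) + suc (suc (2 + k))) + (1 + 1 + (k + suc (suc k)))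
  z = ℕ-Solver.solve-∀

denominator²-denominator : ∀ k → denominator (1 + k) *ₚ denominator (1 + k) *ₚ denominator k
                                ≡ κ (1 + k) *ₚ (Z *ₚ Z *ₚ denominator k)
denominator²-denominator k = trans (mono-≡ (x k) (y k) (z k))
  (cong (_*ₚ (Z *ₚ Z *ₚ denominator k)) (sym (κ-mono (1 + k))))
  where
  x : ∀ k → (1 + k) + (1 + k) + k ≡ (1 + k) * 2 + (0 + 0 + k)
  x = ℕ-Solver.solve-∀
  y : ∀ k → suc (1 + k) + suc (1 + k) + suc k ≡ (2 + (1 + k) * 2) + (0 + 0 + suc k)
  y = ℕ-Solver.solve-∀
  z : ∀ k → ((1 + k) + suc (suc (1 + k))) + ((1 + k) + suc (suc (1 + k))) + (k + suc (suc k))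
          ≡ (2 + (1 + k) * 4) + (1 + 1 + (k + suc (suc k)))
  z = ℕ-Solver.solve-∀

markov-expansions : ∀ k → Expansion (markov (1 + k)) (S (1 + k)) (denominator k)
                        × Expansion (markov (2 + k)) (S (2 + k)) (denominator (1 + k))
markov-expansions zero =
  record { factor = 1ₚ ; num≋ = ≋-by-evaluation ; den≋ = ≋-by-evaluation } ,
  record { factor = Z *ₚ Z ; num≋ = ≋-by-evaluation ; den≋ = ≋-by-evaluation }
markov-expansions (suc k) with markov-expansions k
... | e₁ , e₂ = e₂ , sqsumDiv-expansion (num M₁₁) Z (Z *ₚ Z *ₚ denominator k) (κ (1 + k)) e₂ e₁
  ≋-refl (≋-reflexive (denominator²-denominator k)) (≋-reflexive (denominator²-z² k)) (cassini (1 + k))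

markov-isNumerator : ∀ j → IsNumerator (suc j) (suc (suc j)) (markov (suc j)) (numerator (suc j))
markov-isNumerator j = ≋⇒≈ₚ (expansion-cross (proj₁ (markov-expansions j)))

numerator-unique : ∀ j P → IsNumerator (suc j) (suc (suc j)) (markov (suc j)) P → squareVars P ≋ S (suc j)
numerator-unique j P isNum = *ₚ-cancelˡ-positive (proj₂ (markov-positive (suc j))) (begin
  den (markov (suc j)) *ₚ squareVars P       ≈⟨ ≋-sym (≈ₚ⇒≋ isNum) ⟩
  num (markov (suc j)) *ₚ denominator j      ≈⟨ expansion-cross (proj₁ (markov-expansions j)) ⟩
  den (markov (suc j)) *ₚ S (suc j)          ∎)
  where open ≋-Reasoning

-- The coefficient A₁,ₙ

-- The coefficient recurrence read off P_{k+2} = (u² + 2uv + uw + v² + vw) P_{k+1} − uvw² P_k.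
coeffₘ-numerator-step : ∀ k γ {a₁ a₂ a₃ a₄ a₅ b} →
  shiftedCoeff (numerator (1 + k)) (2 , 0 , 0) γ ≡ a₁ →
  shiftedCoeff (numerator (1 + k)) (1 , 1 , 0) γ ≡ a₂ →
  shiftedCoeff (numerator (1 + k)) (1 , 0 , 1) γ ≡ a₃ →
  shiftedCoeff (numerator (1 + k)) (0 , 2 , 0) γ ≡ a₄ →
  shiftedCoeff (numerator (1 + k)) (0 , 1 , 1) γ ≡ a₅ →
  shiftedCoeff (numerator k) (1 , 1 , 2) γ ≡ b →
  coeffₘ (numerator (2 + k)) γ ≡ a₁ +ℤ (a₂ +ℤ (a₃ +ℤ (a₂ +ℤ (a₄ +ℤ (a₅ +ℤ 0ℤ))))) +ℤ -ℤ (b +ℤ 0ℤ)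
coeffₘ-numerator-step k γ e₁ e₂ e₃ e₄ e₅ e =
  trans (coeffₘ-++ (T *ₚ numerator (1 + k)) (-ₚ (uvw² *ₚ numerator k)) γ)
    (cong₂ _+ℤ_
      (trans (coeffₘ-*-shifted T (numerator (1 + k)) γ)
        (cong₂ _+ℤ_ (1* e₁) (cong₂ _+ℤ_ (1* e₂) (cong₂ _+ℤ_ (1* e₃) (cong₂ _+ℤ_ (1* e₂)
          (cong₂ _+ℤ_ (1* e₄) (cong₂ _+ℤ_ (1* e₅) refl)))))))
      (trans (coeffₘ-neg (uvw² *ₚ numerator k) γ)
        (cong -ℤ_ (trans (coeffₘ-*-shifted uvw² (numerator k) γ) (cong₂ _+ℤ_ (1* e) refl)))))
  where
  1* : ∀ {x y} → x ≡ y → 1ℤ *ℤ x ≡ y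
  1* {x} x≡y = trans (ℤₚ.*-identityˡ x) x≡y

numerator-u⁰vʲ≡0 : ∀ i j l → j ≤ suc i → coeffₘ (numerator (suc i)) (0 , j , l) ≡ 0ℤ
numerator-u⁰vʲ≡0 zero zero l j≤1 = refl
numerator-u⁰vʲ≡0 zero (suc zero) l j≤1 = refl
numerator-u⁰vʲ≡0 zero (suc (suc j)) l (s≤s ())
numerator-u⁰vʲ≡0 (suc i) j l j≤2+i = coeffₘ-numerator-step i γ
  (shiftedCoeff-vanishes Q (2 , 0 , 0) γ λ { (() , _) })
  (shiftedCoeff-vanishes Q (1 , 1 , 0) γ λ { (() , _) })
  (shiftedCoeff-vanishes Q (1 , 0 , 1) γ λ { (() , _) })
  (shiftedCoeff-vanishes Q (0 , 2 , 0) γ λ _ →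
      numerator-u⁰vʲ≡0 i (j ∸ 2) l (ℕₚ.≤-trans (ℕₚ.∸-monoˡ-≤ 2 j≤2+i) (ℕₚ.n≤1+n i)))
  (shiftedCoeff-vanishes Q (0 , 1 , 1) γ λ _ → numerator-u⁰vʲ≡0 i (j ∸ 1) (l ∸ 1) (ℕₚ.∸-monoˡ-≤ 1 j≤2+i))
  (shiftedCoeff-vanishes (numerator i) (1 , 1 , 2) γ λ { (() , _) })
  where
  γ = (0 , j , l)
  Q = numerator (suc i)

numerator-u⁰v²⁺ⁱwⁱ≡1 : ∀ i → coeffₘ (numerator (suc i)) (0 , 2 + i , i) ≡ 1ℤ
numerator-u⁰v²⁺ⁱwⁱ≡1 zero = refl
numerator-u⁰v²⁺ⁱwⁱ≡1 (suc i) = coeffₘ-numerator-step i γ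
  (shiftedCoeff-vanishes Q (2 , 0 , 0) γ λ { (() , _) })
  (shiftedCoeff-vanishes Q (1 , 1 , 0) γ λ { (() , _) })
  (shiftedCoeff-vanishes Q (1 , 0 , 1) γ λ { (() , _) })
  (shiftedCoeff-divides Q (0 , 2 , 0) γ (z≤n , s≤s (s≤s z≤n) , z≤n) (numerator-u⁰vʲ≡0 i (suc i) (suc i) ℕₚ.≤-refl))
  (shiftedCoeff-divides Q (0 , 1 , 1) γ (z≤n , s≤s z≤n , s≤s z≤n) (numerator-u⁰v²⁺ⁱwⁱ≡1 i))
  (shiftedCoeff-vanishes (numerator i) (1 , 1 , 2) γ λ { (() , _) })
  where
  γ = (0 , 3 + i , 1 + i)
  Q = numerator (suc i)

numerator-u¹vʲ≡0 : ∀ i j l → j ℕ.< 2 + i → coeffₘ (numerator (2 + i)) (1 , j , l) ≡ 0ℤ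
numerator-u¹vʲ≡0 zero zero zero j<2 = refl
numerator-u¹vʲ≡0 zero zero 1 j<2 = refl
numerator-u¹vʲ≡0 zero zero 2 j<2 = refl
numerator-u¹vʲ≡0 zero zero (suc (suc (suc l))) j<2 = refl
numerator-u¹vʲ≡0 zero 1 zero j<2 = refl
numerator-u¹vʲ≡0 zero 1 1 j<2 = refl
numerator-u¹vʲ≡0 zero 1 2 j<2 = refl
numerator-u¹vʲ≡0 zero 1 (suc (suc (suc l))) j<2 = refl
numerator-u¹vʲ≡0 zero (suc (suc j)) l (s≤s (s≤s ()))
numerator-u¹vʲ≡0 (suc i) j l (s≤s j≤2+i) = coeffₘ-numerator-step (suc i) γ
  (shiftedCoeff-vanishes Q (2 , 0 , 0) γ λ { (s≤s () , _) })
  (shiftedCoeff-vanishes Q (1 , 1 , 0) γ λ _ → numerator-u⁰vʲ≡0 (suc i) (j ∸ 1) l (ℕₚ.≤-trans (ℕₚ.m∸n≤m j 1) j≤2+i))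
  (shiftedCoeff-vanishes Q (1 , 0 , 1) γ λ _ → numerator-u⁰vʲ≡0 (suc i) j (l ∸ 1) j≤2+i)
  (shiftedCoeff-vanishes Q (0 , 2 , 0) γ λ _ →
      numerator-u¹vʲ≡0 i (j ∸ 2) l (s≤s (ℕₚ.≤-trans (ℕₚ.∸-monoˡ-≤ 2 j≤2+i) (ℕₚ.n≤1+n i))))
  (shiftedCoeff-vanishes Q (0 , 1 , 1) γ λ _ → numerator-u¹vʲ≡0 i (j ∸ 1) (l ∸ 1) (s≤s (ℕₚ.∸-monoˡ-≤ 1 j≤2+i)))
  (shiftedCoeff-vanishes (numerator (suc i)) (1 , 1 , 2) γ λ _ →
      numerator-u⁰vʲ≡0 i (j ∸ 1) (l ∸ 2) (ℕₚ.∸-monoˡ-≤ 1 j≤2+i))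
  where
  γ = (1 , j , l)
  Q = numerator (2 + i)

numerator-u¹v²⁺ⁱw¹⁺ⁱ≡4 : ∀ i → coeffₘ (numerator (2 + i)) (1 , 2 + i , 1 + i) ≡ + 4
numerator-u¹v²⁺ⁱw¹⁺ⁱ≡4 zero = refl
numerator-u¹v²⁺ⁱw¹⁺ⁱ≡4 (suc i) = coeffₘ-numerator-step (suc i) γ
  (shiftedCoeff-vanishes Q (2 , 0 , 0) γ λ { (s≤s () , _) })
  (shiftedCoeff-divides Q (1 , 1 , 0) γ (s≤s z≤n , s≤s z≤n , z≤n)
      (numerator-u⁰vʲ≡0 (suc i) (2 + i) (2 + i) ℕₚ.≤-refl))
  (shiftedCoeff-divides Q (1 , 0 , 1) γ (s≤s z≤n , z≤n , s≤s z≤n) (numerator-u⁰v²⁺ⁱwⁱ≡1 (suc i)))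
  (shiftedCoeff-divides Q (0 , 2 , 0) γ (z≤n , s≤s (s≤s z≤n) , z≤n) (numerator-u¹vʲ≡0 i (suc i) (2 + i) ℕₚ.≤-refl))
  (shiftedCoeff-divides Q (0 , 1 , 1) γ (z≤n , s≤s z≤n , s≤s z≤n) (numerator-u¹v²⁺ⁱw¹⁺ⁱ≡4 i))
  (shiftedCoeff-divides (numerator (suc i)) (1 , 1 , 2) γ (s≤s z≤n , s≤s z≤n , s≤s (s≤s z≤n))
      (numerator-u⁰v²⁺ⁱwⁱ≡1 i))
  where
  γ = (1 , 3 + i , 2 + i)
  Q = numerator (2 + i)

theorem9p1 : (n : ℕ) → 2 ≤ n →
    (Σ (List Dir) λ ds → medNum (nodeAt ds) ≡ n × medDen (nodeAt ds) ≡ suc n)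
    × ((ds : List Dir) → medNum (nodeAt ds) ≡ n → medDen (nodeAt ds) ≡ suc n →
        (Σ Poly λ P → IsNumerator n (suc n) (Mmed (nodeAt ds)) P)
        × ((P : Poly) → IsNumerator n (suc n) (Mmed (nodeAt ds)) P →
            coeff P 1 n (n ∸ 1) ≡ + 4))
theorem9p1 (suc (suc i)) (s≤s (s≤s z≤n)) =
  (pathTo n , cong proj₁ (mediant-pathTo j) , cong proj₂ (mediant-pathTo j)) , numerators
  where
  j = suc i
  n = suc j
  numerators : (ds : List Dir) → medNum (nodeAt ds) ≡ n → medDen (nodeAt ds) ≡ suc n →
               (Σ Poly λ P → IsNumerator n (suc n) (Mmed (nodeAt ds)) P)
               × ((P : Poly) → IsNumerator n (suc n) (Mmed (nodeAt ds)) P → coeff P 1 n (n ∸ 1) ≡ + 4)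
  numerators ds num≡ den≡ rewrite nodeAt-mediant j ds (cong₂ _,_ num≡ den≡) =
    (numerator n , markov-isNumerator j) , λ P isNum → begin
      coeffₘ P (1 , n , j)                        ≡⟨ coeffₘ-squareVars P (1 , n , j) ⟨
      coeffₘ (squareVars P) (double (1 , n , j))  ≡⟨ coeff-≡ (numerator-unique j P isNum) (double (1 , n , j)) ⟩
      coeffₘ (S n) (double (1 , n , j))           ≡⟨ coeffₘ-squareVars (numerator n) (1 , n , j) ⟩
      coeffₘ (numerator n) (1 , n , j)            ≡⟨ numerator-u¹v²⁺ⁱw¹⁺ⁱ≡4 i ⟩
      + 4                                         ∎
    where open ≡-Reasoning
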